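{- Let $G$ be a finite abelian group. The following are equivalent: (1) $G$ admits three fixed-point-free automorphisms whose product is the identity; (2) when $G$ is written as a direct product of cyclic groups of prime power orders, every cyclic factor whose order is a power of $2$ or a power of $3$ occurs with multiplicity greater than $1$.
   Context: An automorphism of $G$ is fixed-point-free if the only element it fixes is the identity. -}

module Defs where

open import Level using (Level; _⊔_)
open import Algebra.Bundles using (AbelianGroup)
open import Data.Nat using (ℕ; suc; _^_)
open import Data.Nat.Primality using (Prime)
open import Data.Fin using (Fin)
open import Data.Integer as ℤ using (ℤ; +_)
open import Data.Integer.Divisibility as ℤD using ()
open import Data.Product using (Σ; ∃; _×_)
open import Data.Sum using (_⊎_)
open import Relation.Binary.PropositionalEquality using (_≡_; _≢_)

module _ {c ℓ : Level} (G : AbelianGroup c ℓ) where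
  open AbelianGroup G

  IsFinite : Set (c ⊔ ℓ)
  IsFinite = ∃ λ (n : ℕ) → Σ (Fin n → Carrier) λ e → ∀ x → ∃ λ i → e i ≈ x

  record Automorphism : Set (c ⊔ ℓ) where
    field
      fun        : Carrier → Carrier
      cong       : ∀ {x y} → x ≈ y → fun x ≈ fun y
      homo       : ∀ x y → fun (x ∙ y) ≈ fun x ∙ fun y
      injective  : ∀ {x y} → fun x ≈ fun y → x ≈ y
      surjective : ∀ y → ∃ λ x → fun x ≈ y

  open Automorphism public

  FixedPointFree : Automorphism → Set (c ⊔ ℓ)
  FixedPointFree α = ∀ x → fun α x ≈ x → x ≈ ε

  HasFPFTriple : Set (c ⊔ ℓ)
  HasFPFTriple = Σ Automorphism λ α → Σ Automorphism λ β → Σ Automorphism λ γ →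
    FixedPointFree α × FixedPointFree β × FixedPointFree γ ×
    (∀ x → fun α (fun β (fun γ x)) ≈ x)

  -- G ≅ ℤ/q₀ × ⋯ × ℤ/q_{k-1}, the target modelled as (Fin k → ℤ) with
  -- componentwise congruence modulo q i and componentwise addition.
  _≡ₘ_ : {k : ℕ} {q : Fin k → ℕ} → (Fin k → ℤ) → (Fin k → ℤ) → Set
  _≡ₘ_ {q = q} u v = ∀ i → (+ q i) ℤD.∣ (u i ℤ.- v i)

  record CyclicDecomposition (k : ℕ) (q : Fin k → ℕ) : Set (c ⊔ ℓ) where
    field
      iso        : Carrier → (Fin k → ℤ)
      iso-cong   : ∀ {x y} → x ≈ y → _≡ₘ_ {q = q} (iso x) (iso y)
      iso-homo   : ∀ x y → _≡ₘ_ {q = q} (iso (x ∙ y)) (λ i → iso x i ℤ.+ iso y i)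
      iso-inj    : ∀ {x y} → _≡ₘ_ {q = q} (iso x) (iso y) → x ≈ y
      iso-surj   : ∀ v → ∃ λ x → _≡ₘ_ {q = q} (iso x) v

IsPrimePower : ℕ → Set
IsPrimePower q = ∃ λ p → ∃ λ m → Prime p × q ≡ p ^ suc m

IsPowerOf2or3 : ℕ → Set
IsPowerOf2or3 q = ∃ λ m → q ≡ 2 ^ suc m ⊎ q ≡ 3 ^ suc m

Condition2 : (k : ℕ) → (Fin k → ℕ) → Set
Condition2 k q = ∀ i → IsPowerOf2or3 (q i) → ∃ λ j → j ≢ i × q j ≡ q i

-- Identify G with ℤ/q₀ × ⋯ × ℤ/q_{k-1}.
--
-- (2) ⇒ (1): under (2) the coordinates split into blocks of equal order: pairs, triples, and
-- singletons of order prime to 6. On a pair or triple act by fixed integer matrices A, B, C with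
-- A B C = 1 whose differences A - 1, B - 1, C - 1 are invertible over ℤ; on a singleton of order q
-- act by the scalars 2, 2 and 4⁻¹, whose differences with 1 are the units 1 and -3 · 4⁻¹ modulo q.
--
-- (1) ⇒ (2): suppose ℤ/pᵐ⁺¹ with p ∈ {2, 3} occurs only once, at coordinate i₀. Then u = pᵐ e_{i₀}
-- spans a layer on which every endomorphism φ acts, modulo p, by the scalar λ(φ) = φ(e_{i₀})_{i₀};
-- λ is multiplicative and nonzero on automorphisms. A fixed-point-free automorphism α of a finite
-- group has α - 1 bijective, so λ(α) ≢ 0, 1. For p = 2 this is impossible; for p = 3 it forces
-- λ(α) = λ(β) = λ(γ) = 2, contradicting λ(αβγ) = 1 since 2³ ≢ 1 modulo 3.

module Submission where

open import Defs using (IsFinite; Automorphism; HasFPFTriple; CyclicDecomposition; _≡ₘ_; IsPrimePower; IsPowerOf2or3; Condition2)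
import Defs
open import Level using (Level)
open import Algebra.Bundles using (AbelianGroup)
open import Data.Bool using (true; if_then_else_)
open import Data.Empty using (⊥; ⊥-elim)
open import Data.Fin using (Fin; zero; suc; _≟_)
import Data.Fin.Properties as Fin
open import Data.Fin.Subset using (Subset; _∈_; _∉_; _∪_; _─_; _⊆_; ⊤; ∣_∣; inside; outside) renaming (⊥ to ∅)
open import Data.Fin.Subset.Properties using (_∈?_; nonempty?; ∣p∣≤n; Empty-unique; ∉⊥; ∈⊤; x∈p∧x∉q⇒x∈p─q; p∩q≢∅⇒∣p─q∣<∣p∣; x∈p∩q⁺; ⊆-antisym; x∈p∪q⁻; x∈p∪q⁺; drop-there)
open import Data.Integer as ℤ using (ℤ; +_; -[1+_]; _+_; _*_; -_; _-_; 0ℤ; 1ℤ; -1ℤ)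
import Data.Integer.Properties as ℤ
open import Algebra.Properties.Semiring.Sum ℤ.+-*-semiring using (sum; sum-syntax; ∑-comm; *-distribˡ-sum; *-distribʳ-sum; ∑-distrib-+; sum-cong-≗)
open import Data.Integer.DivMod using (_%ℕ_; _/ℕ_; n%ℕd<d; a≡a%ℕn+[a/ℕn]*n)
open import Data.Integer.Divisibility.Signed using (_∣_; _∣?_; divides; ∣ᵤ⇒∣; ∣⇒∣ᵤ; ∣-refl; ∣-trans; ∣m∣n⇒∣m+n; ∣n⇒∣m*n; ∣m⇒∣m*n; *-cancelˡ-∣; *-cancelʳ-∣)
open import Data.Integer.Tactic.RingSolver using (solve-∀)
open import Data.List using (List; []; _∷_; length; map; deduplicate)
open import Data.List.Properties using (length-map; length-removeAt′)
open import Data.List.Relation.Unary.All using (All; []; _∷_)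
import Data.List.Relation.Unary.All as All
open import Data.List.Relation.Unary.All.Properties using (¬Any⇒All¬)
open import Data.List.Relation.Unary.Any using (Any; here; there)
import Data.List.Relation.Unary.Any as Any
open import Data.List.Relation.Unary.AllPairs using ([]; _∷_)
import Data.List.Membership.Setoid as Membership
import Data.List.Membership.Setoid.Properties as MembershipP
import Data.List.Relation.Unary.Unique.DecSetoid as UniqueDec
import Data.List.Relation.Unary.Unique.DecSetoid.Properties as UniqueDecP
import Data.List.Relation.Unary.Unique.Setoid.Properties as UniqueP
open import Data.Nat as ℕ using (ℕ; zero; suc; _^_; _≤_; _<_; s≤s; z≤n)
import Data.Nat.Properties as ℕ
open import Data.Nat.Coprimality using (Coprime; coprime-divisor)
open import Data.Nat.DivMod using (_%_; _/_; m≡m%n+[m/n]*n; m%n<n)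
open import Data.Nat.Divisibility as ℕ∣ using (divides; ∣1⇒≡1) renaming (_∣_ to _ℕ∣_)
open import Data.Nat.Primality using (Prime; prime[2]; prime?; euclidsLemma; prime⇒irreducible; ¬prime[1]; prime⇒nonZero; prime⇒nonTrivial)
open import Data.Product using (∃; _×_; _,_; proj₁; proj₂)
open import Data.Sum using (_⊎_; inj₁; inj₂)
open import Data.Vec using (Vec; []; _∷_; here; there; lookup; tabulate)
open import Data.Vec.Functional using (Vector)
open import Data.Vec.Properties using (lookup∘tabulate; lookup⇒[]=; []=⇒lookup)
open import Function using (_∘_)
open import Function.Bundles using (_⇔_; mk⇔)
open import Relation.Binary.Bundles using (DecSetoid)
open import Relation.Binary.Definitions using (tri<; tri≈; tri>)
open import Relation.Binary.PropositionalEquality using (_≡_; _≢_; refl; sym; trans; cong; cong₂; subst; subst₂; ≢-sym; module ≡-Reasoning)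
import Relation.Binary.Reasoning.Setoid as SetoidReasoning
open import Relation.Nullary using (¬_; Dec; yes; no; ¬?; contradiction)
open import Relation.Nullary.Decidable using (does; dec-true; from-yes; from-no; _×-dec_)

infix 4 _≡_mod_
record _≡_mod_ (a b : ℤ) (n : ℕ) : Set where
  constructor mod-by
  field ∣-difference : + n ∣ a - b
open _≡_mod_ public

∣-linear : ∀ {d x y z} s t → d ∣ x → d ∣ y → z ≡ s * x + t * y → d ∣ z
∣-linear s t d∣x d∣y refl = ∣m∣n⇒∣m+n (∣n⇒∣m*n s d∣x) (∣n⇒∣m*n t d∣y)

∣-scaled : ∀ {d x z} s → d ∣ x → z ≡ s * x → d ∣ z
∣-scaled s d∣x refl = ∣n⇒∣m*n s d∣x

∣0 : ∀ d → d ∣ 0ℤ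
∣0 d = divides 0ℤ (sym (ℤ.*-zeroˡ d))

module _ {n : ℕ} where

  mod-reflexive : ∀ {a b} → a ≡ b → a ≡ b mod n
  mod-reflexive {a} refl = mod-by (subst (+ n ∣_) (sym (ℤ.+-inverseʳ a)) (∣0 (+ n)))

  mod-refl : ∀ {a} → a ≡ a mod n
  mod-refl {a} = mod-reflexive {a} refl

  mod-sym : ∀ {a b} → a ≡ b mod n → b ≡ a mod n
  mod-sym {a} {b} (mod-by a≡b) = mod-by (∣-scaled -1ℤ a≡b (lemma a b))
    where
    lemma : ∀ a b → b - a ≡ -1ℤ * (a - b)
    lemma = solve-∀

  mod-trans : ∀ {a b c} → a ≡ b mod n → b ≡ c mod n → a ≡ c mod n
  mod-trans {a} {b} {c} (mod-by a≡b) (mod-by b≡c) = mod-by (∣-linear 1ℤ 1ℤ a≡b b≡c (lemma a b c))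
    where
    lemma : ∀ a b c → a - c ≡ 1ℤ * (a - b) + 1ℤ * (b - c)
    lemma = solve-∀

  mod-+ : ∀ {a b c d} → a ≡ b mod n → c ≡ d mod n → a + c ≡ b + d mod n
  mod-+ {a} {b} {c} {d} (mod-by a≡b) (mod-by c≡d) = mod-by (∣-linear 1ℤ 1ℤ a≡b c≡d (lemma a b c d))
    where
    lemma : ∀ a b c d → (a + c) - (b + d) ≡ 1ℤ * (a - b) + 1ℤ * (c - d)
    lemma = solve-∀

  mod-*ˡ : ∀ s {a b} → a ≡ b mod n → s * a ≡ s * b mod n
  mod-*ˡ s {a} {b} (mod-by a≡b) = mod-by (∣-scaled s a≡b (lemma s a b))
    where
    lemma : ∀ s a b → s * a - s * b ≡ s * (a - b)
    lemma = solve-∀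

  mod-neg : ∀ {a b} → a ≡ b mod n → - a ≡ - b mod n
  mod-neg {a} {b} (mod-by a≡b) = mod-by (∣-scaled -1ℤ a≡b (lemma a b))
    where
    lemma : ∀ a b → - a - - b ≡ -1ℤ * (a - b)
    lemma = solve-∀

  mod-*ʳ : ∀ s {a b} → a ≡ b mod n → a * s ≡ b * s mod n
  mod-*ʳ s {a} {b} a≡b = subst₂ (_≡_mod n) (ℤ.*-comm s a) (ℤ.*-comm s b) (mod-*ˡ s a≡b)

  mod⇒sub≡0 : ∀ {a b} → a ≡ b mod n → a - b ≡ 0ℤ mod n
  mod⇒sub≡0 {a} {b} (mod-by a≡b) = mod-by (subst (+ n ∣_) (sym (ℤ.+-identityʳ (a - b))) a≡b)

  +-multiple-mod : ∀ a t → a + + n * t ≡ a mod n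
  +-multiple-mod a t = mod-by (divides t (lemma a (+ n) t))
    where
    lemma : ∀ a n t → a + n * t - a ≡ t * n
    lemma = solve-∀

  mod-* : ∀ {a b c d} → a ≡ b mod n → c ≡ d mod n → a * c ≡ b * d mod n
  mod-* {a} {b} {c} {d} a≡b c≡d = mod-trans (mod-*ʳ c a≡b) (mod-*ˡ b c≡d)

mod-weaken : ∀ {m n a b} → m ℕ∣ n → a ≡ b mod n → a ≡ b mod m
mod-weaken m∣n (mod-by n∣a-b) = mod-by (∣-trans (∣ᵤ⇒∣ m∣n) n∣a-b)

residue : ∀ a n .{{_ : ℕ.NonZero n}} → ∃ λ ρ → ρ ℕ.< n × a ≡ + ρ mod n
residue a n = a %ℕ n , n%ℕd<d a n , mod-by (divides (a /ℕ n) (quotient-remainder {t = a /ℕ n} {+ n} (a≡a%ℕn+[a/ℕn]*n a n)))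
  where
  quotient-remainder : ∀ {a ρ} {t d} → a ≡ ρ + t * d → a - ρ ≡ t * d
  quotient-remainder {ρ = ρ} {t} {d} refl = lemma ρ t d
    where
    lemma : ∀ ρ t d → ρ + t * d - ρ ≡ t * d
    lemma = solve-∀

mod-cancelʳ : ∀ {n a b} c .{{_ : ℕ.NonZero c}} → a * + c ≡ b * + c mod (n ℕ.* c) → a ≡ b mod n
mod-cancelʳ {n} {a} {b} c (mod-by nc∣ac-bc) = mod-by (*-cancelʳ-∣ (+ c)
  (subst₂ _∣_ (ℤ.pos-* n c) (lemma a b (+ c)) nc∣ac-bc))
  where
  lemma : ∀ a b c → a * c - b * c ≡ (a - b) * c
  lemma = solve-∀

mod-resp : ∀ {m n a b} → m ≡ n → a ≡ b mod m → a ≡ b mod n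
mod-resp refl a≡b = a≡b

pos-∣ : ∀ {a b} → a ℕ∣ b → + a ∣ + b
pos-∣ = ∣ᵤ⇒∣

∣⇒≡0-mod : ∀ {n x} → + n ∣ x → x ≡ 0ℤ mod n
∣⇒≡0-mod {n} {x} n∣x = mod-by (subst (+ n ∣_) (sym (ℤ.+-identityʳ x)) n∣x)

≡0-mod⇒∣ : ∀ {n x} → x ≡ 0ℤ mod n → + n ∣ x
≡0-mod⇒∣ {n} {x} (mod-by n∣x-0) = subst (+ n ∣_) (ℤ.+-identityʳ x) n∣x-0

zero-multiple : ∀ {n x} c → x ≡ 0ℤ mod n → x ≡ c * 0ℤ mod n
zero-multiple {n} {x} c = subst (x ≡_mod n) (sym (ℤ.*-zeroʳ c))

cancel-coprime : ∀ {Q c} x → Coprime Q c → + c * x ≡ 0ℤ mod Q → x ≡ 0ℤ mod Q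
cancel-coprime {Q} {c} x Q⊥c (mod-by Q∣cx) = mod-by (subst (+ Q ∣_) (sym (ℤ.+-identityʳ x)) (∣ᵤ⇒∣ Q∣∣x∣))
  where
  Q∣∣x∣ : Q ℕ∣ ℤ.∣ x ∣
  Q∣∣x∣ = coprime-divisor Q⊥c (subst (Q ℕ∣_) (ℤ.abs-* (+ c) x) (∣⇒∣ᵤ (subst (+ Q ∣_) (ℤ.+-identityʳ (+ c * x)) Q∣cx)))

prime∤prime-power : ∀ {p p′} → Prime p → Prime p′ → p′ ≢ p → ∀ n → ¬ p′ ℕ∣ p ^ n
prime∤prime-power p-prime p′-prime p′≢p zero p′∣1 = ¬prime[1] (subst Prime (∣1⇒≡1 p′∣1) p′-prime)
prime∤prime-power {p} p-prime p′-prime p′≢p (suc n) p′∣pⁿ⁺¹ with euclidsLemma p (p ^ n) p′-prime p′∣pⁿ⁺¹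
... | inj₂ p′∣pⁿ = prime∤prime-power p-prime p′-prime p′≢p n p′∣pⁿ
... | inj₁ p′∣p with prime⇒irreducible p-prime p′∣p
...   | inj₁ refl = ¬prime[1] p′-prime
...   | inj₂ p′≡p = p′≢p p′≡p

prime-power-coprime : ∀ {p p′} → Prime p → Prime p′ → p′ ≢ p → ∀ n → Coprime (p ^ n) p′
prime-power-coprime p-prime p′-prime p′≢p n {d} (d∣pⁿ , d∣p′) with prime⇒irreducible p′-prime d∣p′
... | inj₁ d≡1 = d≡1
... | inj₂ refl = contradiction d∣pⁿ (prime∤prime-power p-prime p′-prime p′≢p n)

odd-of-coprime-2 : ∀ {Q} → Coprime Q 2 → ∃ λ s → Q ≡ 1 ℕ.+ 2 ℕ.* s
odd-of-coprime-2 {Q} Q⊥2 with Q % 2 | m≡m%n+[m/n]*n Q 2 | m%n<n Q 2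
... | 0 | Q≡[Q/2]*2 | _ = contradiction (Q⊥2 (divides (Q / 2) Q≡[Q/2]*2 , ℕ∣.∣-refl)) λ ()
... | 1 | Q≡1+[Q/2]*2 | _ = Q / 2 , trans Q≡1+[Q/2]*2 (cong suc (ℕ.*-comm (Q / 2) 2))
... | suc (suc _) | _ | s≤s (s≤s ())

prime-power-coprime-2-3 : ∀ {Q} → IsPrimePower Q → ¬ IsPowerOf2or3 Q → Coprime Q 2 × Coprime Q 3
prime-power-coprime-2-3 (p , e , p-prime , refl) not-2-or-3 =
  prime-power-coprime p-prime prime[2] (λ 2≡p → not-2-or-3 (e , inj₁ (cong (_^ suc e) (sym 2≡p)))) (suc e) ,
  prime-power-coprime p-prime (from-yes (prime? 3)) (λ 3≡p → not-2-or-3 (e , inj₂ (cong (_^ suc e) (sym 3≡p)))) (suc e)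

^-monoʳ-∣ : ∀ p {a b} → a ≤ b → p ^ a ℕ∣ p ^ b
^-monoʳ-∣ p {a} {b} a≤b = divides (p ^ (b ℕ.∸ a)) (begin
  p ^ b                    ≡⟨ cong (p ^_) (sym (ℕ.m+[n∸m]≡n a≤b)) ⟩
  p ^ (a ℕ.+ (b ℕ.∸ a))    ≡⟨ ℕ.^-distribˡ-+-* p a (b ℕ.∸ a) ⟩
  p ^ a ℕ.* p ^ (b ℕ.∸ a)  ≡⟨ ℕ.*-comm (p ^ a) _ ⟩
  p ^ (b ℕ.∸ a) ℕ.* p ^ a  ∎)
  where open ≡-Reasoning

p·x≡0⇒pᵉ∣x : ∀ {p e x} → Prime p → + p * x ≡ 0ℤ mod (p ^ suc e) → + (p ^ e) ∣ x
p·x≡0⇒pᵉ∣x {p} {e} {x} p-prime px≡0 =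
  *-cancelˡ-∣ (+ p) {{prime⇒nonZero p-prime}} (subst (_∣ + p * x) (ℤ.pos-* p (p ^ e)) (≡0-mod⇒∣ px≡0))

-- Only a coordinate of order exactly pᵐ⁺¹ can carry a p-torsion element of height exactly m.
height-coordinate : ∀ {p m} → Prime p → ∀ {n} → IsPrimePower n → ∀ x y →
  + p * x ≡ 0ℤ mod n → x ≡ + (p ^ m) * y mod n → (n ≡ p ^ suc m → x ≡ 0ℤ mod n) →
  ∃ λ t → x ≡ + (p ^ suc m) * t mod n
height-coordinate {p} {m} p-prime (p′ , e , p′-prime , refl) x y px≡0 x≡pᵐy x≡0-if-top with p′ ℕ.≟ p
... | no p′≢p = 0ℤ , zero-multiple (+ (p ^ suc m))
  (cancel-coprime x (prime-power-coprime p′-prime p-prime (≢-sym p′≢p) (suc e)) px≡0)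
... | yes refl with ℕ.<-cmp e m
...   | tri< e<m _ _ = 0ℤ , zero-multiple (+ (p ^ suc m))
  (mod-trans x≡pᵐy (∣⇒≡0-mod (∣m⇒∣m*n y (pos-∣ (^-monoʳ-∣ p e<m)))))
...   | tri≈ _ refl _ = 0ℤ , zero-multiple (+ (p ^ suc m)) (x≡0-if-top refl)
...   | tri> _ _ m<e with ∣-trans (pos-∣ (^-monoʳ-∣ p m<e)) (p·x≡0⇒pᵉ∣x {e = e} p-prime px≡0)
...     | divides t x≡t*pᵐ⁺¹ = t , mod-reflexive (trans x≡t*pᵐ⁺¹ (ℤ.*-comm t _))

-- Residue vectors

module ResidueVectors (k : ℕ) (q : Fin k → ℕ) where

  V : Set
  V = Fin k → ℤ

  infix 4 _≈ᵥ_
  record _≈ᵥ_ (u v : V) : Set where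
    constructor mk≈
    field at : ∀ i → u i ≡ v i mod q i
  open _≈ᵥ_ public

  0ᵥ : V
  0ᵥ _ = 0ℤ

  infixl 6 _⊕_
  _⊕_ : V → V → V
  (u ⊕ v) i = u i + v i

  ⊖_ : V → V
  (⊖ u) i = - u i

  infixr 7 _·_
  _·_ : ℤ → V → V
  (t · u) i = t * u i

  ≈-pointwise : ∀ {u v} → (∀ i → u i ≡ v i) → u ≈ᵥ v
  ≈-pointwise u≡v = mk≈ λ i → mod-reflexive (u≡v i)

  ≈-refl : ∀ {u} → u ≈ᵥ u
  ≈-refl = ≈-pointwise λ _ → refl

  ≈-sym : ∀ {u v} → u ≈ᵥ v → v ≈ᵥ u
  ≈-sym u≈v = mk≈ λ i → mod-sym (at u≈v i)

  ≈-trans : ∀ {u v w} → u ≈ᵥ v → v ≈ᵥ w → u ≈ᵥ w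
  ≈-trans u≈v v≈w = mk≈ λ i → mod-trans (at u≈v i) (at v≈w i)

  ⊕-cong : ∀ {u u′ v v′} → u ≈ᵥ u′ → v ≈ᵥ v′ → u ⊕ v ≈ᵥ u′ ⊕ v′
  ⊕-cong u≈u′ v≈v′ = mk≈ λ i → mod-+ (at u≈u′ i) (at v≈v′ i)

  ⊖-cong : ∀ {u v} → u ≈ᵥ v → ⊖ u ≈ᵥ ⊖ v
  ⊖-cong u≈v = mk≈ λ i → mod-neg (at u≈v i)

  ·-cong : ∀ t {u v} → u ≈ᵥ v → t · u ≈ᵥ t · v
  ·-cong t u≈v = mk≈ λ i → mod-*ˡ t (at u≈v i)

  _≈?_ : ∀ u v → Dec (u ≈ᵥ v)
  u ≈? v with Fin.all? (λ i → + q i ∣? (u i - v i))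
  ... | yes u≈v = yes (mk≈ λ i → mod-by (u≈v i))
  ... | no u≉v = no (λ u≈v → u≉v λ i → ∣-difference (at u≈v i))

  decSetoid : DecSetoid _ _
  decSetoid = record
    { Carrier = V ; _≈_ = _≈ᵥ_
    ; isDecEquivalence = record
      { isEquivalence = record { refl = ≈-refl ; sym = ≈-sym ; trans = ≈-trans }
      ; _≟_ = _≈?_ } }

  record Endo : Set where
    field
      fun      : V → V
      fun-cong : ∀ {u v} → u ≈ᵥ v → fun u ≈ᵥ fun v
      fun-homo : ∀ u v → fun (u ⊕ v) ≈ᵥ fun u ⊕ fun v

    fun-0 : fun 0ᵥ ≈ᵥ 0ᵥ
    fun-0 = mk≈ λ i → mod-by (∣-scaled -1ℤ (∣-difference (at 0+0 i)) (lemma (fun 0ᵥ i)))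
      where
      0+0 : fun 0ᵥ ≈ᵥ fun 0ᵥ ⊕ fun 0ᵥ
      0+0 = ≈-trans (fun-cong (≈-pointwise λ _ → refl)) (fun-homo 0ᵥ 0ᵥ)
      lemma : ∀ a → a - 0ℤ ≡ -1ℤ * (a - (a + a))
      lemma = solve-∀

    fun-⊖ : ∀ v → fun (⊖ v) ≈ᵥ ⊖ fun v
    fun-⊖ v = mk≈ λ i → mod-by (∣-linear -1ℤ 1ℤ (∣-difference (at (fun-homo v (⊖ v)) i)) (∣-difference (at v-v i))
                                   (lemma (fun v i) (fun (⊖ v) i) (fun (v ⊕ ⊖ v) i)))
      where
      v-v : fun (v ⊕ ⊖ v) ≈ᵥ 0ᵥ
      v-v = ≈-trans (fun-cong (≈-pointwise λ i → ℤ.+-inverseʳ (v i))) fun-0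
      lemma : ∀ a b c → b - (- a) ≡ -1ℤ * (c - (a + b)) + 1ℤ * (c - 0ℤ)
      lemma = solve-∀

    fun-·ℕ : ∀ n v → fun (+ n · v) ≈ᵥ + n · fun v
    fun-·ℕ zero v = ≈-trans (fun-cong (≈-pointwise λ i → ℤ.*-zeroˡ (v i)))
                      (≈-trans fun-0 (≈-pointwise λ i → sym (ℤ.*-zeroˡ (fun v i))))
    fun-·ℕ (suc n) v =
      ≈-trans (fun-cong (≈-pointwise λ i → unfold (v i)))
        (≈-trans (fun-homo v (+ n · v))
          (≈-trans (⊕-cong (≈-refl {fun v}) (fun-·ℕ n v)) (≈-pointwise λ i → sym (unfold (fun v i)))))
      where
      unfold : ∀ a → + suc n * a ≡ a + + n * a
      unfold a = ℤ.suc-* (+ n) a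

    fun-· : ∀ t v → fun (t · v) ≈ᵥ t · fun v
    fun-· (+ n) v = fun-·ℕ n v
    fun-· -[1+ n ] v =
      ≈-trans (fun-cong (≈-pointwise λ i → negate (v i)))
        (≈-trans (fun-⊖ (+ suc n · v))
          (≈-trans (⊖-cong (fun-·ℕ (suc n) v)) (≈-pointwise λ i → sym (negate (fun v i)))))
      where
      negate : ∀ a → -[1+ n ] * a ≡ - (+ suc n * a)
      negate a = sym (ℤ.neg-distribˡ-* (+ suc n) a)

  open Endo public

  _∘ₑ_ : Endo → Endo → Endo
  φ ∘ₑ ψ = record
    { fun      = λ v → fun φ (fun ψ v)
    ; fun-cong = λ u≈v → fun-cong φ (fun-cong ψ u≈v)
    ; fun-homo = λ u v → ≈-trans (fun-cong φ (fun-homo ψ u v)) (fun-homo φ (fun ψ u) (fun ψ v)) }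

  _−id : Endo → Endo
  φ −id = record
    { fun      = λ v i → fun φ v i - v i
    ; fun-cong = λ u≈v → mk≈ λ i → mod-+ (at (fun-cong φ u≈v) i) (mod-neg (at u≈v i))
    ; fun-homo = λ u v → mk≈ λ i → subst ((fun φ (u ⊕ v) i - (u i + v i)) ≡_mod q i) (regroup (fun φ u i) (fun φ v i) (u i) (v i))
                                     (mod-+ (at (fun-homo φ u v) i) (mod-refl {a = - (u i + v i)})) }
    where
    regroup : ∀ a b c d → a + b + - (c + d) ≡ (a - c) + (b - d)
    regroup = solve-∀

  Injective Surjective FixedPointFree : Endo → Set
  Injective φ = ∀ {v w} → fun φ v ≈ᵥ fun φ w → v ≈ᵥ w
  Surjective φ = ∀ w → ∃ λ v → fun φ v ≈ᵥ w
  FixedPointFree φ = ∀ v → fun φ v ≈ᵥ v → v ≈ᵥ 0ᵥ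

  fixed-point-free⇒−id-injective : ∀ φ → FixedPointFree φ → Injective (φ −id)
  fixed-point-free⇒−id-injective φ φ-fpf {v} {w} φv-v≈φw-w = mk≈ λ i → mod-by (∣-scaled 1ℤ (∣-difference (at d≈0 i)) (lemma (v i) (w i)))
    where
    d = v ⊕ ⊖ w
    φd≈φv-φw : fun φ d ≈ᵥ fun φ v ⊕ ⊖ fun φ w
    φd≈φv-φw = ≈-trans (fun-homo φ v (⊖ w)) (⊕-cong (≈-refl {fun φ v}) (fun-⊖ φ w))
    d≈0 : d ≈ᵥ 0ᵥ
    d≈0 = φ-fpf d (mk≈ λ i → mod-by (∣-linear 1ℤ 1ℤ (∣-difference (at φd≈φv-φw i)) (∣-difference (at φv-v≈φw-w i))
                                      (regroup (fun φ d i) (fun φ v i) (fun φ w i) (v i) (w i))))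
      where
      regroup : ∀ a b c x y → a - (x + - y) ≡ 1ℤ * (a - (b + - c)) + 1ℤ * ((b - x) - (c - y))
      regroup = solve-∀
    lemma : ∀ a b → a - b ≡ 1ℤ * ((a + - b) - 0ℤ)
    lemma = solve-∀

  record FixedPointFreeTriple : Set where
    field
      α β γ            : Endo
      α-injective      : Injective α
      β-injective      : Injective β
      γ-injective      : Injective γ
      α-fixed-point-free : FixedPointFree α
      β-fixed-point-free : FixedPointFree β
      γ-fixed-point-free : FixedPointFree γ
      αβγ≈id           : ∀ v → fun α (fun β (fun γ v)) ≈ᵥ v

-- Integer matrices

Matrix : ℕ → Set
Matrix n = Fin n → Fin n → ℤ

module _ {n : ℕ} where

  infixr 7 _*ᵥ_ _*ₘ_
  _*ᵥ_ : Matrix n → Vector ℤ n → Vector ℤ n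
  (M *ᵥ x) a = ∑[ b < n ] (M a b * x b)

  _*ₘ_ : Matrix n → Matrix n → Matrix n
  (A *ₘ B) a c = ∑[ b < n ] (A a b * B b c)

  infixl 6 _−ₘ_
  _−ₘ_ : Matrix n → Matrix n → Matrix n
  (A −ₘ B) a b = A a b - B a b

matrix : ∀ {n} → Vec (Vec ℤ n) n → Matrix n
matrix rows a b = lookup (lookup rows a) b

𝟙 : ∀ {n} → Matrix n
𝟙 zero    zero    = 1ℤ
𝟙 zero    (suc _) = 0ℤ
𝟙 (suc _) zero    = 0ℤ
𝟙 (suc a) (suc b) = 𝟙 a b

∑-zero : ∀ n → ∑[ b < n ] 0ℤ ≡ 0ℤ
∑-zero zero    = refl
∑-zero (suc n) = trans (ℤ.+-identityˡ _) (∑-zero n)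

∑-neg : ∀ {n} (f : Vector ℤ n) → ∑[ b < n ] (- f b) ≡ - sum f
∑-neg {zero}  f = refl
∑-neg {suc n} f = trans (cong (λ s → - f zero + s) (∑-neg (λ b → f (suc b)))) (sym (ℤ.neg-distrib-+ (f zero) _))

∑-mod : ∀ {Q n} {f g : Vector ℤ n} → (∀ b → f b ≡ g b mod Q) → sum f ≡ sum g mod Q
∑-mod {n = zero}  f≡g = mod-refl {a = 0ℤ}
∑-mod {n = suc n} f≡g = mod-+ (f≡g zero) (∑-mod (λ b → f≡g (suc b)))

module _ {n : ℕ} where

  *ᵥ-cong : ∀ (M : Matrix n) {x y} → (∀ b → x b ≡ y b) → ∀ a → (M *ᵥ x) a ≡ (M *ᵥ y) a
  *ᵥ-cong M x≗y a = sum-cong-≗ λ b → cong (M a b *_) (x≗y b)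

  *ᵥ-+ : ∀ (M : Matrix n) x y a → (M *ᵥ (λ b → x b + y b)) a ≡ (M *ᵥ x) a + (M *ᵥ y) a
  *ᵥ-+ M x y a = trans (sum-cong-≗ λ b → ℤ.*-distribˡ-+ (M a b) (x b) (y b))
                       (∑-distrib-+ (λ b → M a b * x b) (λ b → M a b * y b))

  *ᵥ-mod : ∀ {Q} (M : Matrix n) {x y} → (∀ b → x b ≡ y b mod Q) → ∀ a → (M *ᵥ x) a ≡ (M *ᵥ y) a mod Q
  *ᵥ-mod M x≡y a = ∑-mod λ b → mod-*ˡ (M a b) (x≡y b)

  *ᵥ-entries-mod : ∀ {Q} {M N : Matrix n} → (∀ a b → M a b ≡ N a b mod Q) → ∀ x a → (M *ᵥ x) a ≡ (N *ᵥ x) a mod Q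
  *ᵥ-entries-mod M≡N x a = ∑-mod λ b → mod-*ʳ (x b) (M≡N a b)

  *ₘ-*ᵥ : ∀ (A B : Matrix n) x a → ((A *ₘ B) *ᵥ x) a ≡ (A *ᵥ (B *ᵥ x)) a
  *ₘ-*ᵥ A B x a = begin
    ∑[ c < n ] (∑[ b < n ] (A a b * B b c) * x c)  ≡⟨ sum-cong-≗ (λ c → *-distribʳ-sum (x c) (λ b → A a b * B b c)) ⟩
    ∑[ c < n ] ∑[ b < n ] (A a b * B b c * x c)    ≡⟨ ∑-comm (λ c b → A a b * B b c * x c) ⟩
    ∑[ b < n ] ∑[ c < n ] (A a b * B b c * x c)    ≡⟨ sum-cong-≗ (λ b → trans (sum-cong-≗ λ c → ℤ.*-assoc (A a b) (B b c) (x c))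
                                                                        (sym (*-distribˡ-sum (A a b) (λ c → B b c * x c)))) ⟩
    ∑[ b < n ] (A a b * ∑[ c < n ] (B b c * x c))  ∎
    where open ≡-Reasoning

𝟙-*ᵥ : ∀ {n} (x : Vector ℤ n) a → (𝟙 *ᵥ x) a ≡ x a
𝟙-*ᵥ {suc n} x zero = begin
  1ℤ * x zero + ∑[ b < n ] (0ℤ * x (suc b))  ≡⟨ cong₂ _+_ (ℤ.*-identityˡ (x zero)) (sum-cong-≗ λ b → ℤ.*-zeroˡ (x (suc b))) ⟩
  x zero + ∑[ b < n ] 0ℤ                     ≡⟨ cong (λ s → x zero + s) (∑-zero n) ⟩
  x zero + 0ℤ                                ≡⟨ ℤ.+-identityʳ (x zero) ⟩
  x zero                                     ∎
  where open ≡-Reasoning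
𝟙-*ᵥ {suc n} x (suc a) = trans (ℤ.+-identityˡ _) (𝟙-*ᵥ (λ b → x (suc b)) a)

−ₘ𝟙-*ᵥ : ∀ {n} (M : Matrix n) x a → ((M −ₘ 𝟙) *ᵥ x) a ≡ (M *ᵥ x) a - x a
−ₘ𝟙-*ᵥ {n} M x a = begin
  ∑[ b < n ] ((M a b - 𝟙 a b) * x b)               ≡⟨ sum-cong-≗ (λ b → distrib (M a b) (𝟙 a b) (x b)) ⟩
  ∑[ b < n ] (M a b * x b + - (𝟙 a b * x b))       ≡⟨ ∑-distrib-+ (λ b → M a b * x b) (λ b → - (𝟙 a b * x b)) ⟩
  (M *ᵥ x) a + ∑[ b < n ] (- (𝟙 a b * x b))        ≡⟨ cong (λ s → (M *ᵥ x) a + s) (trans (∑-neg (λ b → 𝟙 a b * x b)) (cong -_ (𝟙-*ᵥ x a))) ⟩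
  (M *ᵥ x) a - x a                                  ∎
  where
  open ≡-Reasoning
  distrib : ∀ m e y → (m - e) * y ≡ m * y + - (e * y)
  distrib = solve-∀

FixedPointFreeMod : ℕ → ∀ {n} → Matrix n → Set
FixedPointFreeMod Q M = ∀ x → (∀ a → (M *ᵥ x) a ≡ x a mod Q) → ∀ a → x a ≡ 0ℤ mod Q

left-inverse⇒fixed-point-free : ∀ {Q n} (M N : Matrix n) → (∀ a b → (N *ₘ (M −ₘ 𝟙)) a b ≡ 𝟙 a b) →
                                FixedPointFreeMod Q M
left-inverse⇒fixed-point-free {Q} {n} M N N[M-𝟙]≡𝟙 x Mx≡x a =
  subst₂ (_≡_mod Q) x≡N[Mx-x] N0≡0 (*ᵥ-mod N (λ b → mod⇒sub≡0 (Mx≡x b)) a)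
  where
  open ≡-Reasoning
  x≡N[Mx-x] : (N *ᵥ (λ b → (M *ᵥ x) b - x b)) a ≡ x a
  x≡N[Mx-x] = begin
    (N *ᵥ (λ b → (M *ᵥ x) b - x b)) a  ≡⟨ *ᵥ-cong N (λ b → sym (−ₘ𝟙-*ᵥ M x b)) a ⟩
    (N *ᵥ ((M −ₘ 𝟙) *ᵥ x)) a           ≡⟨ sym (*ₘ-*ᵥ N (M −ₘ 𝟙) x a) ⟩
    ((N *ₘ (M −ₘ 𝟙)) *ᵥ x) a           ≡⟨ sum-cong-≗ (λ b → cong (_* x b) (N[M-𝟙]≡𝟙 a b)) ⟩
    (𝟙 *ᵥ x) a                         ≡⟨ 𝟙-*ᵥ x a ⟩
    x a                                ∎
  N0≡0 : (N *ᵥ (λ _ → 0ℤ)) a ≡ 0ℤ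
  N0≡0 = trans (sum-cong-≗ λ b → ℤ.*-zeroʳ (N a b)) (∑-zero n)

record MatrixTriple (Q n : ℕ) : Set where
  field
    A B C : Matrix n
    A-fpf : FixedPointFreeMod Q A
    B-fpf : FixedPointFreeMod Q B
    C-fpf : FixedPointFreeMod Q C
    ABC≡𝟙 : ∀ a b → (A *ₘ (B *ₘ C)) a b ≡ 𝟙 a b mod Q
    BCA≡𝟙 : ∀ a b → (B *ₘ (C *ₘ A)) a b ≡ 𝟙 a b mod Q
    CAB≡𝟙 : ∀ a b → (C *ₘ (A *ₘ B)) a b ≡ 𝟙 a b mod Q

infix 4 _≗ₘ_ _≟ₘ_
_≗ₘ_ : ∀ {n} → Matrix n → Matrix n → Set
M ≗ₘ N = ∀ a b → M a b ≡ N a b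

_≟ₘ_ : ∀ {n} (M N : Matrix n) → Dec (M ≗ₘ N)
M ≟ₘ N = Fin.all? λ a → Fin.all? λ b → M a b ℤ.≟ N a b

integerTriple : ∀ {n} (A B C NA NB NC : Matrix n) →
  NA *ₘ (A −ₘ 𝟙) ≗ₘ 𝟙 → NB *ₘ (B −ₘ 𝟙) ≗ₘ 𝟙 → NC *ₘ (C −ₘ 𝟙) ≗ₘ 𝟙 →
  A *ₘ (B *ₘ C) ≗ₘ 𝟙 → B *ₘ (C *ₘ A) ≗ₘ 𝟙 → C *ₘ (A *ₘ B) ≗ₘ 𝟙 → ∀ Q → MatrixTriple Q n
integerTriple A B C NA NB NC NA-inv NB-inv NC-inv ABC BCA CAB Q = record
  { A = A ; B = B ; C = C
  ; A-fpf = left-inverse⇒fixed-point-free A NA NA-inv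
  ; B-fpf = left-inverse⇒fixed-point-free B NB NB-inv
  ; C-fpf = left-inverse⇒fixed-point-free C NC NC-inv
  ; ABC≡𝟙 = λ a b → mod-reflexive (ABC a b)
  ; BCA≡𝟙 = λ a b → mod-reflexive (BCA a b)
  ; CAB≡𝟙 = λ a b → mod-reflexive (CAB a b) }

matrixTriple₂ : ∀ Q → MatrixTriple Q 2
matrixTriple₂ = integerTriple A B C NA NB NC
  (from-yes (NA *ₘ (A −ₘ 𝟙) ≟ₘ 𝟙)) (from-yes (NB *ₘ (B −ₘ 𝟙) ≟ₘ 𝟙)) (from-yes (NC *ₘ (C −ₘ 𝟙) ≟ₘ 𝟙))
  (from-yes (A *ₘ (B *ₘ C) ≟ₘ 𝟙)) (from-yes (B *ₘ (C *ₘ A) ≟ₘ 𝟙)) (from-yes (C *ₘ (A *ₘ B) ≟ₘ 𝟙))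
  where
  A B C NA NB NC : Matrix 2
  A  = matrix ((-1ℤ ∷ -1ℤ ∷ []) ∷ (-1ℤ ∷ 0ℤ ∷ []) ∷ [])
  B  = matrix (( 1ℤ ∷ -1ℤ ∷ []) ∷ (-1ℤ ∷ 0ℤ ∷ []) ∷ [])
  C  = matrix (( 1ℤ ∷ -1ℤ ∷ []) ∷ ( 1ℤ ∷ 0ℤ ∷ []) ∷ [])
  NA = matrix ((-1ℤ ∷  1ℤ ∷ []) ∷ ( 1ℤ ∷ - + 2 ∷ []) ∷ [])
  NB = matrix (( 1ℤ ∷ -1ℤ ∷ []) ∷ (-1ℤ ∷ 0ℤ ∷ []) ∷ [])
  NC = matrix ((-1ℤ ∷  1ℤ ∷ []) ∷ (-1ℤ ∷ 0ℤ ∷ []) ∷ [])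

matrixTriple₃ : ∀ Q → MatrixTriple Q 3
matrixTriple₃ = integerTriple A A C NA NA NC
  (from-yes (NA *ₘ (A −ₘ 𝟙) ≟ₘ 𝟙)) (from-yes (NA *ₘ (A −ₘ 𝟙) ≟ₘ 𝟙)) (from-yes (NC *ₘ (C −ₘ 𝟙) ≟ₘ 𝟙))
  (from-yes (A *ₘ (A *ₘ C) ≟ₘ 𝟙)) (from-yes (A *ₘ (C *ₘ A) ≟ₘ 𝟙)) (from-yes (C *ₘ (A *ₘ A) ≟ₘ 𝟙))
  where
  A C NA NC : Matrix 3
  A  = matrix ((-1ℤ ∷ -1ℤ ∷  0ℤ ∷ []) ∷ ( 0ℤ ∷  0ℤ ∷ -1ℤ ∷ []) ∷ ( 1ℤ ∷ 0ℤ ∷ 0ℤ ∷ []) ∷ [])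
  C  = matrix (( 0ℤ ∷ -1ℤ ∷  0ℤ ∷ []) ∷ ( 0ℤ ∷  1ℤ ∷ -1ℤ ∷ []) ∷ ( 1ℤ ∷ 0ℤ ∷ 1ℤ ∷ []) ∷ [])
  NA = matrix ((-1ℤ ∷  1ℤ ∷ -1ℤ ∷ []) ∷ ( 1ℤ ∷ - + 2 ∷ + 2 ∷ []) ∷ (-1ℤ ∷ 1ℤ ∷ - + 2 ∷ []) ∷ [])
  NC = matrix (( 0ℤ ∷  0ℤ ∷  1ℤ ∷ []) ∷ (-1ℤ ∷  0ℤ ∷ -1ℤ ∷ []) ∷ ( 0ℤ ∷ -1ℤ ∷ 0ℤ ∷ []) ∷ [])

scalar : ℤ → Matrix 1
scalar t _ _ = t

scalar-*ₘ : ∀ t M → (scalar t *ₘ M) zero zero ≡ t * M zero zero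
scalar-*ₘ t M = ℤ.+-identityʳ (t * M zero zero)

scalar-fpf : ∀ {Q} t → (∀ x → t * x ≡ x mod Q → x ≡ 0ℤ mod Q) → FixedPointFreeMod Q (scalar t)
scalar-fpf t t-fpf x fixed zero = t-fpf (x zero) (subst (_≡ x zero mod _) (ℤ.+-identityʳ (t * x zero)) (fixed zero))

scalar-product : ∀ {Q} a b c → a * (b * c) ≡ 1ℤ mod Q → ∀ i j → (scalar a *ₘ (scalar b *ₘ scalar c)) i j ≡ 𝟙 i j mod Q
scalar-product a b c abc≡1 zero zero =
  subst (_≡ 1ℤ mod _) (sym (trans (scalar-*ₘ a (scalar b *ₘ scalar c)) (cong (a *_) (scalar-*ₘ b (scalar c))))) abc≡1

scalarTriple : ∀ {Q} s → Q ≡ 1 ℕ.+ 2 ℕ.* s → Coprime Q 3 → MatrixTriple Q 1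
scalarTriple {Q} s Q≡1+2s Q⊥3 = record
  { A = scalar (+ 2) ; B = scalar (+ 2) ; C = scalar H
  ; A-fpf = scalar-fpf (+ 2) 2-fpf
  ; B-fpf = scalar-fpf (+ 2) 2-fpf
  ; C-fpf = scalar-fpf H H-fpf
  ; ABC≡𝟙 = scalar-product (+ 2) (+ 2) H (4H≡1 refl)
  ; BCA≡𝟙 = scalar-product (+ 2) H (+ 2) (4H≡1 (cong (+ 2 *_) (ℤ.*-comm H (+ 2))))
  ; CAB≡𝟙 = scalar-product H (+ 2) (+ 2) (4H≡1 (trans (ℤ.*-comm H (+ 2 * + 2)) (ℤ.*-assoc (+ 2) (+ 2) H))) }
  where
  S Qℤ H : ℤ
  S  = + s
  Qℤ = 1ℤ + + 2 * S
  -- H = ((Q + 1) / 2)² is the inverse of 4 modulo Q.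
  H  = (S + 1ℤ) * (S + 1ℤ)

  Q≡Qℤ : + Q ≡ Qℤ
  Q≡Qℤ = trans (cong +_ Q≡1+2s) (trans (ℤ.pos-+ 1 (2 ℕ.* s)) (cong (λ z → 1ℤ + z) (ℤ.pos-* 2 s)))

  4H≡1 : ∀ {a} → a ≡ + 2 * (+ 2 * H) → a ≡ 1ℤ mod Q
  4H≡1 refl = mod-by (subst (_∣ (+ 2 * (+ 2 * H) - 1ℤ)) (sym Q≡Qℤ) (divides (Qℤ + + 2) (lemma S)))
    where
    lemma : ∀ S → + 2 * (+ 2 * ((S + 1ℤ) * (S + 1ℤ))) - 1ℤ ≡ ((1ℤ + + 2 * S) + + 2) * (1ℤ + + 2 * S)
    lemma = solve-∀

  2-fpf : ∀ x → + 2 * x ≡ x mod Q → x ≡ 0ℤ mod Q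
  2-fpf x (mod-by Q∣2x-x) = mod-by (∣-scaled 1ℤ Q∣2x-x (lemma x))
    where
    lemma : ∀ x → x - 0ℤ ≡ 1ℤ * (+ 2 * x - x)
    lemma = solve-∀

  -- 4 (H - 1) ≡ -3 modulo Q, so a fixed point of H is killed by 3, which is invertible modulo Q.
  H-fpf : ∀ x → H * x ≡ x mod Q → x ≡ 0ℤ mod Q
  H-fpf x (mod-by Q∣Hx-x) = cancel-coprime x Q⊥3 (mod-by
    (∣-linear (- + 4) ((Qℤ + + 2) * x) Q∣Hx-x (subst (_∣ Qℤ) (sym Q≡Qℤ) (divides 1ℤ (sym (ℤ.*-identityˡ Qℤ))))
              (lemma x S)))
    where
    lemma : ∀ x S → + 3 * x - 0ℤ ≡ - + 4 * ((S + 1ℤ) * (S + 1ℤ) * x - x) + ((1ℤ + + 2 * S) + + 2) * x * (1ℤ + + 2 * S)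
    lemma = solve-∀

matrixTriple₁ : ∀ {Q} → IsPrimePower Q → ¬ IsPowerOf2or3 Q → MatrixTriple Q 1
matrixTriple₁ Q-prime-power not-2-or-3 with prime-power-coprime-2-3 Q-prime-power not-2-or-3
... | Q⊥2 , Q⊥3 with odd-of-coprime-2 Q⊥2
...   | s , Q≡1+2s = scalarTriple s Q≡1+2s Q⊥3

-- Endomorphisms supported on a set of coordinates

x∈p─q⁻ : ∀ {n} {x : Fin n} (p q : Subset n) → x ∈ p ─ q → x ∈ p × x ∉ q
x∈p─q⁻ {x = zero} (inside ∷ p)  (outside ∷ q) here = here , λ ()
x∈p─q⁻ {x = zero} (outside ∷ p) (outside ∷ q) ()
x∈p─q⁻ {x = zero} (_ ∷ p)       (inside ∷ q)  ()
x∈p─q⁻ {x = suc _} (_ ∷ p) (_ ∷ q) (there x∈p─q) with x∈p─q⁻ p q x∈p─q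
... | x∈p , x∉q = there x∈p , λ x∈q → x∉q (drop-there x∈q)

p─q∪q≡p : ∀ {n} {p q : Subset n} → q ⊆ p → (p ─ q) ∪ q ≡ p
p─q∪q≡p {p = p} {q} q⊆p = ⊆-antisym
  (λ x∈ → case (x∈p∪q⁻ (p ─ q) q x∈))
  (λ {x} x∈p → case′ x∈p (x ∈? q))
  where
  case : ∀ {x} → _ → x ∈ p
  case (inj₁ x∈p─q) = proj₁ (x∈p─q⁻ p q x∈p─q)
  case (inj₂ x∈q)   = q⊆p x∈q
  case′ : ∀ {x} → x ∈ p → Dec (x ∈ q) → x ∈ (p ─ q) ∪ q
  case′ x∈p (yes x∈q) = x∈p∪q⁺ (inj₂ x∈q)
  case′ x∈p (no x∉q)  = x∈p∪q⁺ (inj₁ (x∈p∧x∉q⇒x∈p─q x∈p x∉q))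

module Supported (k : ℕ) (q : Fin k → ℕ) where
  open ResidueVectors k q

  AgreeOn : Subset k → V → V → Set
  AgreeOn S u v = ∀ {i} → i ∈ S → u i ≡ v i

  record SupportedEnd (S : Subset k) : Set where
    field
      endo             : Endo
      off-support      : ∀ v {i} → i ∉ S → fun endo v i ≡ v i
      local            : ∀ {u v} → AgreeOn S u v → AgreeOn S (fun endo u) (fun endo v)
      fixed-point-free : ∀ v → (∀ {i} → i ∈ S → fun endo v i ≡ v i mod q i) →
                         ∀ {i} → i ∈ S → v i ≡ 0ℤ mod q i
  open SupportedEnd public

  record SupportedTriple (S : Subset k) : Set where
    field
      α β γ : SupportedEnd S
      αβγ≈id : ∀ v → fun (endo α) (fun (endo β) (fun (endo γ) v)) ≈ᵥ v
      βγα≈id : ∀ v → fun (endo β) (fun (endo γ) (fun (endo α) v)) ≈ᵥ v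
      γαβ≈id : ∀ v → fun (endo γ) (fun (endo α) (fun (endo β) v)) ≈ᵥ v
  open SupportedTriple public

  full-support-fpf : (φ : SupportedEnd ⊤) → FixedPointFree (endo φ)
  full-support-fpf φ v φv≈v = mk≈ λ i → fixed-point-free φ v (λ {j} _ → at φv≈v j) ∈⊤

  idSupported : SupportedEnd ∅
  idSupported = record
    { endo             = record { fun = λ v → v ; fun-cong = λ u≈v → u≈v ; fun-homo = λ _ _ → ≈-refl }
    ; off-support      = λ _ _ → refl
    ; local            = λ u≈v → u≈v
    ; fixed-point-free = λ _ _ i∈⊥ → contradiction i∈⊥ ∉⊥ }

  idTriple : SupportedTriple ∅
  idTriple = record
    { α = idSupported ; β = idSupported ; γ = idSupported
    ; αβγ≈id = λ _ → ≈-refl ; βγα≈id = λ _ → ≈-refl ; γαβ≈id = λ _ → ≈-refl }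

  Disjoint : Subset k → Subset k → Set
  Disjoint S T = ∀ {i} → i ∈ S → i ∉ T

  module _ {S T : Subset k} (S∩T≡∅ : Disjoint S T) where

    off-both : ∀ {i} → i ∉ S ∪ T → i ∉ S × i ∉ T
    off-both i∉S∪T = (λ i∈S → i∉S∪T (x∈p∪q⁺ (inj₁ i∈S))) , (λ i∈T → i∉S∪T (x∈p∪q⁺ (inj₂ i∈T)))

    module _ (φ : SupportedEnd S) (ψ : SupportedEnd T) where

      private
        f = fun (endo φ)
        g = fun (endo ψ)

      agree-left : ∀ {w w′} → AgreeOn S w w′ → AgreeOn S (f (g w)) (f w′)
      agree-left w≡w′ = local φ (λ {i} i∈S → trans (off-support ψ _ (S∩T≡∅ i∈S)) (w≡w′ i∈S))

      agree-right : ∀ {w w′} → AgreeOn T w w′ → AgreeOn T (f (g w)) (g w′)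
      agree-right w≡w′ {i} i∈T = trans (off-support φ _ (λ i∈S → S∩T≡∅ i∈S i∈T)) (local ψ w≡w′ i∈T)

      union : SupportedEnd (S ∪ T)
      union = record
        { endo             = endo φ ∘ₑ endo ψ
        ; off-support      = λ v i∉S∪T → let i∉S , i∉T = off-both i∉S∪T in
                               trans (off-support φ _ i∉S) (off-support ψ v i∉T)
        ; local            = λ u≡v i∈S∪T → agree (λ j∈S → u≡v (x∈p∪q⁺ (inj₁ j∈S))) (λ j∈T → u≡v (x∈p∪q⁺ (inj₂ j∈T)))
                                                 (x∈p∪q⁻ S T i∈S∪T)
        ; fixed-point-free = fpf }
        where
        agree : ∀ {u v} → AgreeOn S u v → AgreeOn T u v → ∀ {i} → i ∈ S ⊎ i ∈ T → f (g u) i ≡ f (g v) i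
        agree u≡v _ (inj₁ i∈S) = trans (agree-left u≡v i∈S) (sym (agree-left (λ _ → refl) i∈S))
        agree _ u≡v (inj₂ i∈T) = trans (agree-right u≡v i∈T) (sym (agree-right (λ _ → refl) i∈T))
        fpf : ∀ v → (∀ {i} → i ∈ S ∪ T → f (g v) i ≡ v i mod q i) → ∀ {i} → i ∈ S ∪ T → v i ≡ 0ℤ mod q i
        fpf v fixed i∈S∪T with x∈p∪q⁻ S T i∈S∪T
        ... | inj₁ i∈S = fixed-point-free φ v
              (λ j∈S → subst (_≡ v _ mod q _) (agree-left (λ _ → refl) j∈S) (fixed (x∈p∪q⁺ (inj₁ j∈S)))) i∈S
        ... | inj₂ i∈T = fixed-point-free ψ v
              (λ j∈T → subst (_≡ v _ mod q _) (agree-right (λ _ → refl) j∈T) (fixed (x∈p∪q⁺ (inj₂ j∈T)))) i∈T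

    union-product : (φ₁ φ₂ φ₃ : SupportedEnd S) (ψ₁ ψ₂ ψ₃ : SupportedEnd T) →
      (∀ v → fun (endo φ₁) (fun (endo φ₂) (fun (endo φ₃) v)) ≈ᵥ v) →
      (∀ v → fun (endo ψ₁) (fun (endo ψ₂) (fun (endo ψ₃) v)) ≈ᵥ v) →
      ∀ v → fun (endo (union φ₁ ψ₁)) (fun (endo (union φ₂ ψ₂)) (fun (endo (union φ₃ ψ₃)) v)) ≈ᵥ v
    union-product φ₁ φ₂ φ₃ ψ₁ ψ₂ ψ₃ φ-id ψ-id v = mk≈ coordinate
      where
      on-S : AgreeOn S _ _
      on-S = agree-left φ₁ ψ₁ (agree-left φ₂ ψ₂ (agree-left φ₃ ψ₃ (λ _ → refl)))
      on-T : AgreeOn T _ _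
      on-T = agree-right φ₁ ψ₁ (agree-right φ₂ ψ₂ (agree-right φ₃ ψ₃ (λ _ → refl)))
      coordinate : ∀ i → _ ≡ v i mod q i
      coordinate i with i ∈? (S ∪ T)
      ... | no i∉S∪T = mod-reflexive (trans (off-support (union φ₁ ψ₁) _ i∉S∪T)
                          (trans (off-support (union φ₂ ψ₂) _ i∉S∪T) (off-support (union φ₃ ψ₃) v i∉S∪T)))
      ... | yes i∈S∪T with x∈p∪q⁻ S T i∈S∪T
      ...   | inj₁ i∈S = subst (_≡ v i mod q i) (sym (on-S i∈S)) (at (φ-id v) i)
      ...   | inj₂ i∈T = subst (_≡ v i mod q i) (sym (on-T i∈T)) (at (ψ-id v) i)

    unionTriple : SupportedTriple S → SupportedTriple T → SupportedTriple (S ∪ T)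
    unionTriple t u = record
      { α = union (α t) (α u) ; β = union (β t) (β u) ; γ = union (γ t) (γ u)
      ; αβγ≈id = union-product (α t) (β t) (γ t) (α u) (β u) (γ u) (αβγ≈id t) (αβγ≈id u)
      ; βγα≈id = union-product (β t) (γ t) (α t) (β u) (γ u) (α u) (βγα≈id t) (βγα≈id u)
      ; γαβ≈id = union-product (γ t) (α t) (β t) (γ u) (α u) (β u) (γαβ≈id t) (γαβ≈id u) }

∷-lookup-injective : ∀ {n k} {x : Fin k} {xs : Vec (Fin k) n} → (∀ a → lookup xs a ≢ x) →
  (∀ {a b} → lookup xs a ≡ lookup xs b → a ≡ b) → ∀ {a b} → lookup (x ∷ xs) a ≡ lookup (x ∷ xs) b → a ≡ b
∷-lookup-injective x∉xs xs-inj {zero}  {zero}  _     = refl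
∷-lookup-injective x∉xs xs-inj {zero}  {suc b} x≡xᵦ  = contradiction (sym x≡xᵦ) (x∉xs b)
∷-lookup-injective x∉xs xs-inj {suc a} {zero}  xₐ≡x  = contradiction xₐ≡x (x∉xs a)
∷-lookup-injective x∉xs xs-inj {suc a} {suc b} xₐ≡xᵦ = cong suc (xs-inj xₐ≡xᵦ)

[]-lookup-injective : ∀ {k} {a b : Fin 0} → lookup ([] {A = Fin k}) a ≡ lookup [] b → a ≡ b
[]-lookup-injective {a = ()}

module Image {n k : ℕ} (ι : Fin n → Fin k) where

  preimage : ∀ l → Dec (∃ λ a → ι a ≡ l)
  preimage l = Fin.any? (λ a → ι a ≟ l)

  image : Subset k
  image = tabulate (does ∘ preimage)

  ∈image⁺ : ∀ a → ι a ∈ image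
  ∈image⁺ a = lookup⇒[]= (ι a) image (trans (lookup∘tabulate _ (ι a)) (dec-true (preimage (ι a)) (a , refl)))

  ∈image⁻ : ∀ {l} → l ∈ image → ∃ λ a → ι a ≡ l
  ∈image⁻ {l} l∈image = witness (preimage l) (trans (sym (lookup∘tabulate _ l)) ([]=⇒lookup l∈image))
    where
    witness : (d : Dec (∃ λ a → ι a ≡ l)) → does d ≡ true → ∃ λ a → ι a ≡ l
    witness (yes w) _ = w

  ∉image⁺ : ∀ {l} → (∀ a → ι a ≢ l) → l ∉ image
  ∉image⁺ ι≢l l∈image = let a , ιa≡l = ∈image⁻ l∈image in ι≢l a ιa≡l

  ∉image⇒≢ : ∀ {l} → l ∉ image → ∀ a → ι a ≢ l
  ∉image⇒≢ l∉image a ιa≡l = l∉image (subst (_∈ image) ιa≡l (∈image⁺ a))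

module Block (k : ℕ) (q : Fin k → ℕ) {n : ℕ} (ι : Fin n → Fin k)
             (ι-injective : ∀ {a b} → ι a ≡ ι b → a ≡ b) {Q : ℕ} (q∘ι≡Q : ∀ a → q (ι a) ≡ Q) where
  open ResidueVectors k q
  open Supported k q
  open Image ι public

  by-coordinates : (P : Fin k → Set) → (∀ a → P (ι a)) → (∀ {l} → l ∉ image → P l) → ∀ l → P l
  by-coordinates P on-block off-block l with l ∈? image
  ... | yes l∈image with ∈image⁻ l∈image
  ...   | a , refl = on-block a
  by-coordinates P on-block off-block l | no l∉image = off-block l∉image

  infixr 5 _▸_
  _▸_ : Matrix n → V → V
  (M ▸ v) l with preimage l
  ... | yes (a , _) = (M *ᵥ (v ∘ ι)) a
  ... | no _        = v l

  ▸-inside : ∀ M v a → (M ▸ v) (ι a) ≡ (M *ᵥ (v ∘ ι)) a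
  ▸-inside M v a with preimage (ι a)
  ... | yes (a′ , ιa′≡ιa) rewrite ι-injective ιa′≡ιa = refl
  ... | no ∄a = contradiction (a , refl) ∄a

  ▸-outside : ∀ M v {l} → l ∉ image → (M ▸ v) l ≡ v l
  ▸-outside M v {l} l∉image with preimage l
  ... | yes (a , refl) = contradiction (∈image⁺ a) l∉image
  ... | no _           = refl

  restrict-mod : ∀ {u v} → u ≈ᵥ v → ∀ a → u (ι a) ≡ v (ι a) mod Q
  restrict-mod u≈v a = mod-resp (q∘ι≡Q a) (at u≈v (ι a))

  blockEnd : (M : Matrix n) → FixedPointFreeMod Q M → SupportedEnd image
  blockEnd M M-fpf = record
    { endo = record
      { fun      = M ▸_
      ; fun-cong = λ {u} {v} u≈v → mk≈ (by-coordinates (λ l → (M ▸ u) l ≡ (M ▸ v) l mod q l)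
          (λ a → subst₂ (_≡_mod q (ι a)) (sym (▸-inside M u a)) (sym (▸-inside M v a))
                   (mod-resp (sym (q∘ι≡Q a)) (*ᵥ-mod M (restrict-mod u≈v) a)))
          (λ l∉image → subst₂ (_≡_mod q _) (sym (▸-outside M u l∉image)) (sym (▸-outside M v l∉image)) (at u≈v _)))
      ; fun-homo = λ u v → ≈-pointwise (by-coordinates (λ l → (M ▸ (u ⊕ v)) l ≡ (M ▸ u) l + (M ▸ v) l)
          (λ a → trans (▸-inside M (u ⊕ v) a) (trans (*ᵥ-+ M (u ∘ ι) (v ∘ ι) a)
                   (sym (cong₂ _+_ (▸-inside M u a) (▸-inside M v a)))))
          (λ l∉image → trans (▸-outside M (u ⊕ v) l∉image)
                   (sym (cong₂ _+_ (▸-outside M u l∉image) (▸-outside M v l∉image))))) }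
    ; off-support = λ v → ▸-outside M v
    ; local = λ {u} {v} u≡v {l} l∈image → local-at u≡v (∈image⁻ l∈image)
    ; fixed-point-free = λ v fixed {l} l∈image → fpf-at v fixed (∈image⁻ l∈image) }
    where
    local-at : ∀ {u v} → AgreeOn image u v → ∀ {l} → (∃ λ a → ι a ≡ l) → (M ▸ u) l ≡ (M ▸ v) l
    local-at {u} {v} u≡v (a , refl) =
      trans (▸-inside M u a) (trans (*ᵥ-cong M (λ b → u≡v (∈image⁺ b)) a) (sym (▸-inside M v a)))
    fpf-at : ∀ v → (∀ {l} → l ∈ image → (M ▸ v) l ≡ v l mod q l) → ∀ {l} → (∃ λ a → ι a ≡ l) → v l ≡ 0ℤ mod q l
    fpf-at v fixed (a , refl) = mod-resp (sym (q∘ι≡Q a)) (M-fpf (v ∘ ι)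
      (λ b → subst (_≡ v (ι b) mod Q) (▸-inside M v b) (mod-resp (q∘ι≡Q b) (fixed (∈image⁺ b)))) a)

  ▸-product : ∀ A B C → (∀ a b → (A *ₘ (B *ₘ C)) a b ≡ 𝟙 a b mod Q) → ∀ v → A ▸ B ▸ C ▸ v ≈ᵥ v
  ▸-product A B C ABC≡𝟙 v = mk≈ (by-coordinates (λ l → (A ▸ B ▸ C ▸ v) l ≡ v l mod q l)
    (λ a → mod-resp (sym (q∘ι≡Q a)) (subst₂ (_≡_mod Q) (sym (on-block a)) (𝟙-*ᵥ (v ∘ ι) a)
             (*ᵥ-entries-mod ABC≡𝟙 (v ∘ ι) a)))
    (λ l∉image → mod-reflexive (trans (▸-outside A _ l∉image)
                   (trans (▸-outside B _ l∉image) (▸-outside C v l∉image)))))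
    where
    open ≡-Reasoning
    on-block : ∀ a → (A ▸ B ▸ C ▸ v) (ι a) ≡ ((A *ₘ (B *ₘ C)) *ᵥ (v ∘ ι)) a
    on-block a = begin
      (A ▸ B ▸ C ▸ v) (ι a)                  ≡⟨ ▸-inside A _ a ⟩
      (A *ᵥ ((B ▸ C ▸ v) ∘ ι)) a             ≡⟨ *ᵥ-cong A (▸-inside B _) a ⟩
      (A *ᵥ (B *ᵥ ((C ▸ v) ∘ ι))) a          ≡⟨ *ᵥ-cong A (*ᵥ-cong B (▸-inside C v)) a ⟩
      (A *ᵥ (B *ᵥ (C *ᵥ (v ∘ ι)))) a         ≡⟨ *ᵥ-cong A (λ b → sym (*ₘ-*ᵥ B C (v ∘ ι) b)) a ⟩
      (A *ᵥ ((B *ₘ C) *ᵥ (v ∘ ι))) a         ≡⟨ sym (*ₘ-*ᵥ A (B *ₘ C) (v ∘ ι) a) ⟩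
      ((A *ₘ (B *ₘ C)) *ᵥ (v ∘ ι)) a         ∎

  blockTriple : MatrixTriple Q n → SupportedTriple image
  blockTriple d = record
    { α = blockEnd A A-fpf ; β = blockEnd B B-fpf ; γ = blockEnd C C-fpf
    ; αβγ≈id = ▸-product A B C ABC≡𝟙
    ; βγα≈id = ▸-product B C A BCA≡𝟙
    ; γαβ≈id = ▸-product C A B CAB≡𝟙 }
    where open MatrixTriple d

module Assembly (k : ℕ) (q : Fin k → ℕ) where
  open Supported k q

  PairedOn : Subset k → Set
  PairedOn S = ∀ {i} → i ∈ S → IsPowerOf2or3 (q i) → ∃ λ j → j ≢ i × j ∈ S × q j ≡ q i

  record BlockAt (S : Subset k) (i : Fin k) : Set where
    field
      {size}           : ℕ
      members          : Vec (Fin k) size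
      members-distinct : ∀ {a b} → lookup members a ≡ lookup members b → a ≡ b
      members-order    : ∀ a → q (lookup members a) ≡ q i
      members⊆S        : ∀ a → lookup members a ∈ S
      matrices         : MatrixTriple (q i) size

  module BlockAtProperties {S i} (b : BlockAt S i) where
    open BlockAt b public
    open Block k q (lookup members) members-distinct members-order public

    image⊆S : image ⊆ S
    image⊆S l∈image with ∈image⁻ l∈image
    ... | a , refl = members⊆S a

    ClosedClass : Set
    ClosedClass = ∀ {l} → l ∈ S ─ image → q l ≡ q i → ∃ λ m → m ≢ l × m ∈ S ─ image × q m ≡ q i

    remainder-paired : PairedOn S → ClosedClass → PairedOn (S ─ image)
    remainder-paired paired closed {l} l∈rest l-2or3
      with l∈S , l∉image ← x∈p─q⁻ S image l∈rest
      with j , j≢l , j∈S , q[j]≡q[l] ← paired l∈S l-2or3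
      with j ∈? image
    ... | no j∉image = j , j≢l , x∈p∧x∉q⇒x∈p─q j∈S j∉image , q[j]≡q[l]
    ... | yes j∈image with ∈image⁻ j∈image
    ...   | a , refl with closed l∈rest (trans (sym q[j]≡q[l]) (members-order a))
    ...     | m , m≢l , m∈rest , q[m]≡q[i] = m , m≢l , m∈rest , trans q[m]≡q[i] (trans (sym (members-order a)) q[j]≡q[l])

    extend : SupportedTriple (S ─ image) → SupportedTriple S
    extend t = subst SupportedTriple (p─q∪q≡p image⊆S)
      (unionTriple (λ l∈rest → proj₂ (x∈p─q⁻ S image l∈rest)) t (blockTriple matrices))

  Fellow : ∀ {n} → Subset k → Vec (Fin k) n → Fin k → Set
  Fellow S xs i = ∃ λ j → j ∈ S × (∀ a → lookup xs a ≢ j) × q j ≡ q i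

  fellow? : ∀ {n} S (xs : Vec (Fin k) n) i → Dec (Fellow S xs i)
  fellow? S xs i = Fin.any? λ j → (j ∈? S) ×-dec Fin.all? (λ a → ¬? (lookup xs a ≟ j)) ×-dec (q j ℕ.≟ q i)

  module _ {S : Subset k} {i : Fin k} where
    open BlockAtProperties using (members; image; ∉image⇒≢; ClosedClass)

    closed-if-no-fellow : (b : BlockAt S i) → ¬ Fellow S (members b) i → ClosedClass b
    closed-if-no-fellow b no-fellow {l} l∈rest q[l]≡q[i] =
      let l∈S , l∉image = x∈p─q⁻ S (image b) l∈rest in contradiction (l , l∈S , ∉image⇒≢ b l∉image , q[l]≡q[i]) no-fellow

  module _ (q-prime-power : ∀ i → IsPrimePower (q i)) {S : Subset k} {i : Fin k} (i∈S : i ∈ S) (paired : PairedOn S) where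
    open BlockAtProperties using (image; ∈image⁺; ∉image⁺; ClosedClass)

    ChosenBlock : Set
    ChosenBlock = ∃ λ (b : BlockAt S i) → i ∈ image b × ClosedClass b

    private
      singleton : MatrixTriple (q i) 1 → BlockAt S i
      singleton m = record
        { members = i ∷ [] ; members-distinct = ∷-lookup-injective (λ ()) []-lookup-injective
        ; members-order = λ { zero → refl } ; members⊆S = λ { zero → i∈S } ; matrices = m }

      pair : ∀ {j} → j ∈ S → i ≢ j → q j ≡ q i → BlockAt S i
      pair {j} j∈S i≢j q[j]≡q[i] = record
        { members          = i ∷ j ∷ []
        ; members-distinct = ∷-lookup-injective (λ { zero → ≢-sym i≢j }) (∷-lookup-injective (λ ()) []-lookup-injective)
        ; members-order    = λ { zero → refl ; (suc zero) → q[j]≡q[i] }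
        ; members⊆S        = λ { zero → i∈S ; (suc zero) → j∈S }
        ; matrices         = matrixTriple₂ (q i) }

      triple : ∀ {j j′} → j ∈ S → i ≢ j → q j ≡ q i → j′ ∈ S → i ≢ j′ → j ≢ j′ → q j′ ≡ q i → BlockAt S i
      triple {j} {j′} j∈S i≢j q[j]≡q[i] j′∈S i≢j′ j≢j′ q[j′]≡q[i] = record
        { members          = i ∷ j ∷ j′ ∷ []
        ; members-distinct = ∷-lookup-injective (λ { zero → ≢-sym i≢j ; (suc zero) → ≢-sym i≢j′ })
                               (∷-lookup-injective (λ { zero → ≢-sym j≢j′ }) (∷-lookup-injective (λ ()) []-lookup-injective))
        ; members-order    = λ { zero → refl ; (suc zero) → q[j]≡q[i] ; (suc (suc zero)) → q[j′]≡q[i] }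
        ; members⊆S        = λ { zero → i∈S ; (suc zero) → j∈S ; (suc (suc zero)) → j′∈S }
        ; matrices         = matrixTriple₃ (q i) }

    chooseBlock : ChosenBlock
    chooseBlock with fellow? S (i ∷ []) i
    ... | no no-fellow = b , ∈image⁺ b zero , closed-if-no-fellow b no-fellow
      where
      not-2-or-3 : ¬ IsPowerOf2or3 (q i)
      not-2-or-3 q[i]-2or3 with paired i∈S q[i]-2or3
      ... | j , j≢i , j∈S , q[j]≡q[i] = no-fellow (j , j∈S , (λ { zero → ≢-sym j≢i }) , q[j]≡q[i])
      b = singleton (matrixTriple₁ (q-prime-power i) not-2-or-3)
    ... | yes (j , j∈S , j∉[i] , q[j]≡q[i]) with fellow? S (i ∷ j ∷ []) i
    ...   | no no-fellow = b , ∈image⁺ b zero , closed-if-no-fellow b no-fellow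
      where b = pair j∈S (j∉[i] zero) q[j]≡q[i]
    ...   | yes (j′ , j′∈S , j′∉[i,j] , q[j′]≡q[i]) with fellow? S (i ∷ j ∷ j′ ∷ []) i
    ...     | no no-fellow = b , ∈image⁺ b zero , closed-if-no-fellow b no-fellow
      where b = triple j∈S (j∉[i] zero) q[j]≡q[i] j′∈S (j′∉[i,j] zero) (j′∉[i,j] (suc zero)) q[j′]≡q[i]
    ...     | yes (j″ , j″∈S , j″∉[i,j,j′] , q[j″]≡q[i]) = b , ∈image⁺ b zero , closed
      where
      b = pair j∈S (j∉[i] zero) q[j]≡q[i]
      -- at least two members of the class of q i, namely j′ and j″, stay outside the pair
      closed : ClosedClass b
      closed {l} _ _ with l ≟ j′
      ... | yes refl = j″ , ≢-sym (j″∉[i,j,j′] (suc (suc zero))) ,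
                       x∈p∧x∉q⇒x∈p─q j″∈S (∉image⁺ b λ { zero → j″∉[i,j,j′] zero ; (suc zero) → j″∉[i,j,j′] (suc zero) }) ,
                       q[j″]≡q[i]
      ... | no l≢j′ = j′ , ≢-sym l≢j′ , x∈p∧x∉q⇒x∈p─q j′∈S (∉image⁺ b j′∉[i,j]) , q[j′]≡q[i]

  module _ (q-prime-power : ∀ i → IsPrimePower (q i)) where
    open BlockAtProperties using (image; remainder-paired; extend)

    assemble : ∀ n {S} → ∣ S ∣ < n → PairedOn S → SupportedTriple S
    assemble (suc n) {S} |S|<1+n paired with nonempty? S
    ... | no empty = subst SupportedTriple (sym (Empty-unique empty)) idTriple
    ... | yes (i , i∈S) with chooseBlock q-prime-power i∈S paired
    ...   | b , i∈B , closed = extend b (assemble n smaller (remainder-paired b paired closed))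
      where
      smaller : ∣ S ─ image b ∣ < n
      smaller = ℕ.<-≤-trans (p∩q≢∅⇒∣p─q∣<∣p∣ S (image b) (i , x∈p∩q⁺ (i∈S , i∈B))) (ℕ.≤-pred |S|<1+n)

    fullTriple : PairedOn ⊤ → SupportedTriple ⊤
    fullTriple = assemble (suc k) (s≤s (∣p∣≤n ⊤))

-- The layer of a non-repeated factor of order 2ᵐ⁺¹ or 3ᵐ⁺¹

module Layer (k : ℕ) (q : Fin k → ℕ) (q-prime-power : ∀ j → IsPrimePower (q j))
             (i₀ : Fin k) {p m : ℕ} (p-prime : Prime p) (q[i₀]≡pᵐ⁺¹ : q i₀ ≡ p ^ suc m)
             (unique : ∀ j → q j ≡ q i₀ → j ≡ i₀) where
  open ResidueVectors k q

  r Q : ℕ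
  r = p ^ m
  Q = p ^ suc m

  instance
    p-nonZero : ℕ.NonZero p
    p-nonZero = prime⇒nonZero p-prime
    r-nonZero : ℕ.NonZero r
    r-nonZero = ℕ.m^n≢0 p m

  e₀ : V
  e₀ l = if does (l ≟ i₀) then 1ℤ else 0ℤ

  e₀-i₀ : e₀ i₀ ≡ 1ℤ
  e₀-i₀ rewrite dec-true (i₀ ≟ i₀) refl = refl

  u : V
  u = + r · e₀

  λ[_] : Endo → ℤ
  λ[ φ ] = fun φ e₀ i₀

  at-i₀ : ∀ {v w} → v ≈ᵥ w → v i₀ ≡ w i₀ mod Q
  at-i₀ v≈w = mod-resp q[i₀]≡pᵐ⁺¹ (at v≈w i₀)

  p·u≈0 : + p · u ≈ᵥ 0ᵥ
  p·u≈0 = mk≈ coordinate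
    where
    coordinate : ∀ l → + p * (+ r * e₀ l) ≡ 0ℤ mod q l
    coordinate l with l ≟ i₀
    ... | yes refl = mod-resp (sym q[i₀]≡pᵐ⁺¹)
                       (∣⇒≡0-mod (divides 1ℤ (trans (lemma (+ p) (+ r)) (cong (1ℤ *_) (sym (ℤ.pos-* p r))))))
      where
      lemma : ∀ p r → p * (r * 1ℤ) ≡ 1ℤ * (p * r)
      lemma = solve-∀
    ... | no _ = mod-reflexive (trans (cong (+ p *_) (ℤ.*-zeroʳ (+ r))) (ℤ.*-zeroʳ (+ p)))

  height : ∀ {x y} → + p · x ≈ᵥ 0ᵥ → x ≈ᵥ + r · y → x i₀ ≡ 0ℤ mod q i₀ → ∃ λ z → x ≈ᵥ + Q · z
  height {x} {y} p·x≈0 x≈r·y x[i₀]≡0 = (λ j → proj₁ (at-coordinate j)) , mk≈ (λ j → proj₂ (at-coordinate j))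
    where
    top-is-i₀ : ∀ j → q j ≡ Q → x j ≡ 0ℤ mod q j
    top-is-i₀ j q[j]≡Q with unique j (trans q[j]≡Q (sym q[i₀]≡pᵐ⁺¹))
    ... | refl = x[i₀]≡0
    at-coordinate : ∀ j → ∃ λ t → x j ≡ + Q * t mod q j
    at-coordinate j = height-coordinate {m = m} p-prime (q-prime-power j) (x j) (y j) (at p·x≈0 j) (at x≈r·y j) (top-is-i₀ j)

  OnLayer : ℤ → V → Set
  OnLayer c v = ∃ λ z → v ≈ᵥ c · u ⊕ + Q · z

  on-layer-i₀ : ∀ {c v} → OnLayer c v → v i₀ ≡ c * + r mod Q
  on-layer-i₀ {c} (z , v≈) = mod-trans (at-i₀ v≈)
    (subst (λ e → c * (+ r * e) + + Q * z i₀ ≡ c * + r mod Q) (sym e₀-i₀)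
      (subst (λ a → a + + Q * z i₀ ≡ c * + r mod Q) (sym (cong (c *_) (ℤ.*-identityʳ (+ r))))
        (+-multiple-mod (c * + r) (z i₀))))

  -- φ u - λ[ φ ] · u is killed by p, divisible by pᵐ and zero at i₀, so `height` applies.
  fun-u-on-layer : ∀ φ → OnLayer λ[ φ ] (fun φ u)
  fun-u-on-layer φ = z , ≈-trans (≈-pointwise λ i → split (fun φ u i) (λ[ φ ] * u i)) (⊕-cong (≈-refl {λ[ φ ] · u}) x≈Q·z)
    where
    f = fun φ
    l = λ[ φ ]
    x y : V
    x = f u ⊕ ⊖ (l · u)
    y = f e₀ ⊕ ⊖ (l · e₀)

    split : ∀ a b → a ≡ b + (a + - b)
    split = solve-∀
    scale : ∀ p a l b → p * (a + - (l * b)) ≡ p * a + - (l * (p * b))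
    scale = solve-∀
    factor : ∀ r a l b → r * a + - (l * (r * b)) ≡ r * (a + - (l * b))
    factor = solve-∀

    p·x≈0 : + p · x ≈ᵥ 0ᵥ
    p·x≈0 = ≈-trans (≈-pointwise λ i → scale (+ p) (f u i) l (u i))
      (≈-trans (⊕-cong (≈-trans (≈-sym (fun-· φ (+ p) u)) (≈-trans (fun-cong φ p·u≈0) (fun-0 φ)))
                       (⊖-cong (·-cong l p·u≈0)))
               (≈-pointwise λ _ → trans (ℤ.+-identityˡ _) (cong -_ (ℤ.*-zeroʳ l))))

    x≈r·y : x ≈ᵥ + r · y
    x≈r·y = ≈-trans (⊕-cong (fun-· φ (+ r) e₀) (≈-refl {⊖ (l · u)})) (≈-pointwise λ i → factor (+ r) (f e₀ i) l (e₀ i))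

    x[i₀]≡0 : x i₀ ≡ 0ℤ mod q i₀
    x[i₀]≡0 = mod-trans (at x≈r·y i₀) (mod-reflexive (begin
      + r * (l + - (l * e₀ i₀))  ≡⟨ cong (λ e → + r * (l + - (l * e))) e₀-i₀ ⟩
      + r * (l + - (l * 1ℤ))     ≡⟨ cong (λ a → + r * (l + - a)) (ℤ.*-identityʳ l) ⟩
      + r * (l + - l)            ≡⟨ cong (+ r *_) (ℤ.+-inverseʳ l) ⟩
      + r * 0ℤ                   ≡⟨ ℤ.*-zeroʳ (+ r) ⟩
      0ℤ                         ∎))
      where open ≡-Reasoning

    z = proj₁ (height p·x≈0 x≈r·y x[i₀]≡0)
    x≈Q·z = proj₂ (height p·x≈0 x≈r·y x[i₀]≡0)

  fun-on-layer : ∀ φ {c v} → OnLayer c v → OnLayer (c * λ[ φ ]) (fun φ v)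
  fun-on-layer φ {c} {v} (z , v≈) = c · z′ ⊕ fun φ z , (begin
    fun φ v                                   ≈⟨ fun-cong φ v≈ ⟩
    fun φ (c · u ⊕ + Q · z)                   ≈⟨ fun-homo φ _ _ ⟩
    fun φ (c · u) ⊕ fun φ (+ Q · z)           ≈⟨ ⊕-cong (fun-· φ c u) (fun-· φ (+ Q) z) ⟩
    c · fun φ u ⊕ + Q · fun φ z               ≈⟨ ⊕-cong (·-cong c fu≈) (≈-refl {+ Q · fun φ z}) ⟩
    c · (λ[ φ ] · u ⊕ + Q · z′) ⊕ + Q · fun φ z  ≈⟨ ≈-pointwise (λ i → regroup c λ[ φ ] (u i) (+ Q) (z′ i) (fun φ z i)) ⟩
    (c * λ[ φ ]) · u ⊕ + Q · (c · z′ ⊕ fun φ z) ∎)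
    where
    open SetoidReasoning (DecSetoid.setoid decSetoid)
    z′ = proj₁ (fun-u-on-layer φ)
    fu≈ = proj₂ (fun-u-on-layer φ)
    regroup : ∀ c l u Q z w → c * (l * u + Q * z) + Q * w ≡ c * l * u + Q * (c * z + w)
    regroup = solve-∀

  λ-∘ : ∀ φ ψ → λ[ φ ∘ₑ ψ ] ≡ λ[ ψ ] * λ[ φ ] mod p
  λ-∘ φ ψ = mod-cancelʳ r (mod-trans (mod-sym (on-layer-i₀ {λ[ φ ∘ₑ ψ ]} (fun-u-on-layer (φ ∘ₑ ψ))))
                                     (on-layer-i₀ {λ[ ψ ] * λ[ φ ]} (fun-on-layer φ {λ[ ψ ]} (fun-u-on-layer ψ))))

  r<Q : r ℕ.< Q
  r<Q = subst (r ℕ.<_) (ℕ.*-comm r p) (ℕ.m<m*n r p (ℕ.nonTrivial⇒n>1 p {{prime⇒nonTrivial p-prime}}))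

  -- If p divides λ[ φ ], then φ u is a multiple of pᵐ⁺¹, hence so is u, which fails at i₀.
  λ-unit : ∀ φ → Injective φ → Surjective φ → ¬ (λ[ φ ] ≡ 0ℤ mod p)
  λ-unit φ φ-inj φ-surj λ≡0 with ≡0-mod⇒∣ λ≡0
  ... | divides c λ≡c*p = ℕ.<⇒≱ r<Q (ℕ∣.∣⇒≤ (∣⇒∣ᵤ (≡0-mod⇒∣ r≡0)))
    where
    open SetoidReasoning (DecSetoid.setoid decSetoid)
    z = proj₁ (fun-u-on-layer φ)
    w = proj₁ (φ-surj z)
    u≈Q·w : u ≈ᵥ + Q · w
    u≈Q·w = φ-inj (begin
      fun φ u                        ≈⟨ proj₂ (fun-u-on-layer φ) ⟩
      λ[ φ ] · u ⊕ + Q · z           ≈⟨ ⊕-cong (≈-trans (≈-pointwise λ i → trans (cong (_* u i) λ≡c*p) (ℤ.*-assoc c (+ p) (u i)))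
                                                 (≈-trans (·-cong c p·u≈0) (≈-pointwise λ _ → ℤ.*-zeroʳ c)))
                                       (≈-refl {+ Q · z}) ⟩
      0ᵥ ⊕ + Q · z                   ≈⟨ ≈-pointwise (λ i → ℤ.+-identityˡ (+ Q * z i)) ⟩
      + Q · z                        ≈⟨ ·-cong (+ Q) (≈-sym (proj₂ (φ-surj z))) ⟩
      + Q · fun φ w                  ≈⟨ ≈-sym (fun-· φ (+ Q) w) ⟩
      fun φ (+ Q · w)                ∎)
    r≡0 : + r ≡ 0ℤ mod Q
    r≡0 = subst (λ a → a ≡ 0ℤ mod Q) (trans (cong (+ r *_) e₀-i₀) (ℤ.*-identityʳ (+ r)))
            (mod-trans (at-i₀ u≈Q·w) (subst (_≡ 0ℤ mod Q) (ℤ.+-identityˡ (+ Q * w i₀)) (+-multiple-mod 0ℤ (w i₀))))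

  module _ (injective⇒surjective : ∀ φ → Injective φ → Surjective φ) where

    λ≢0 : ∀ φ → Injective φ → ¬ λ[ φ ] ≡ 0ℤ mod p
    λ≢0 φ φ-inj = λ-unit φ φ-inj (injective⇒surjective φ φ-inj)

    λ≢1 : ∀ φ → FixedPointFree φ → ¬ λ[ φ ] ≡ 1ℤ mod p
    λ≢1 φ φ-fpf λ≡1 = λ≢0 (φ −id) (fixed-point-free⇒−id-injective φ φ-fpf)
      (subst (λ e → λ[ φ ] - e ≡ 0ℤ mod p) (sym e₀-i₀) (mod⇒sub≡0 λ≡1))

    residue-2 : p ≡ 2 → ∀ a → a ≡ 0ℤ mod p ⊎ a ≡ 1ℤ mod p
    residue-2 p≡2 a with residue a p
    ... | ρ , ρ<p , a≡ρ with subst (ρ ℕ.<_) p≡2 ρ<p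
    ...   | ℕ.s≤s ℕ.z≤n = inj₁ a≡ρ
    ...   | ℕ.s≤s (ℕ.s≤s ℕ.z≤n) = inj₂ a≡ρ

    residue-3 : p ≡ 3 → ∀ a → ¬ a ≡ 0ℤ mod p → ¬ a ≡ 1ℤ mod p → a ≡ + 2 mod p
    residue-3 p≡3 a a≢0 a≢1 with residue a p
    ... | ρ , ρ<p , a≡ρ with subst (ρ ℕ.<_) p≡3 ρ<p
    ...   | ℕ.s≤s ℕ.z≤n = contradiction a≡ρ a≢0
    ...   | ℕ.s≤s (ℕ.s≤s ℕ.z≤n) = contradiction a≡ρ a≢1
    ...   | ℕ.s≤s (ℕ.s≤s (ℕ.s≤s ℕ.z≤n)) = a≡ρ

    -- For p = 2 one of λ[ φ ] and λ[ φ −id ] = λ[ φ ] - 1 is even.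
    no-fpf-automorphism : p ≡ 2 → ∀ φ → Injective φ → FixedPointFree φ → ⊥
    no-fpf-automorphism p≡2 φ φ-inj φ-fpf with residue-2 p≡2 λ[ φ ]
    ... | inj₁ λ≡0 = λ≢0 φ φ-inj λ≡0
    ... | inj₂ λ≡1 = λ≢1 φ φ-fpf λ≡1

    -- For p = 3 all three scalars are 2, but 2 · 2 · 2 ≢ 1 modulo 3.
    no-fpf-triple : p ≡ 3 → FixedPointFreeTriple → ⊥
    no-fpf-triple p≡3 t = from-no (+ 3 ∣? (1ℤ - + 8)) (∣-difference (mod-resp p≡3 1≡8))
      where
      open FixedPointFreeTriple t
      λ≡2 : ∀ φ → Injective φ → FixedPointFree φ → λ[ φ ] ≡ + 2 mod p
      λ≡2 φ φ-inj φ-fpf = residue-3 p≡3 λ[ φ ] (λ≢0 φ φ-inj) (λ≢1 φ φ-fpf)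
      1≡8 : 1ℤ ≡ + 8 mod p
      1≡8 = mod-trans (mod-sym (mod-weaken (ℕ∣.m∣m*n r) (mod-trans (at-i₀ (αβγ≈id e₀)) (mod-reflexive e₀-i₀))))
              (mod-trans (λ-∘ α (β ∘ₑ γ))
                (mod-* (mod-trans (λ-∘ β γ) (mod-* (λ≡2 γ γ-injective γ-fixed-point-free) (λ≡2 β β-injective β-fixed-point-free)))
                       (λ≡2 α α-injective α-fixed-point-free)))

module FiniteDecSetoid {a ℓ} (S : DecSetoid a ℓ) where
  open DecSetoid S using (Carrier; _≈_; setoid) renaming (_≟_ to _≈?_; sym to ≈-sym; trans to ≈-trans)
  open Membership setoid using () renaming (_∈_ to _∈ₗ_; _∉_ to _∉ₗ_)
  open UniqueDec S using (Unique)

  ∈-─⁺ : ∀ {x y ys} (p : x ∈ₗ ys) → y ∈ₗ ys → ¬ x ≈ y → y ∈ₗ (ys Any.─ p)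
  ∈-─⁺ (here x≈z) (here y≈z) x≉y = contradiction (≈-trans x≈z (≈-sym y≈z)) x≉y
  ∈-─⁺ (here _)   (there y∈) _   = y∈
  ∈-─⁺ (there _)  (here y≈z) _   = here y≈z
  ∈-─⁺ (there p)  (there y∈) x≉y = there (∈-─⁺ p y∈ x≉y)

  unique-⊆⇒length≤ : ∀ {xs ys} → Unique xs → All (_∈ₗ ys) xs → length xs ≤ length ys
  unique-⊆⇒length≤ [] [] = z≤n
  unique-⊆⇒length≤ {ys = ys} (x≉xs ∷ xs!) (x∈ys ∷ xs⊆ys) =
    ℕ.≤-trans (s≤s (unique-⊆⇒length≤ xs! (All.zipWith (λ (x≉y , y∈ys) → ∈-─⁺ x∈ys y∈ys x≉y) (x≉xs , xs⊆ys))))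
            (ℕ.≤-reflexive (sym (length-removeAt′ ys _)))

  injective⇒surjective : ∀ {xs} → (∀ x → x ∈ₗ xs) →
    ∀ {f} → (∀ {x y} → x ≈ y → f x ≈ f y) → (∀ {x y} → f x ≈ f y → x ≈ y) →
    ∀ y → ∃ λ x → f x ≈ y
  injective⇒surjective {xs} xs-covers {f} f-cong f-inj y = search (Any.any? (λ x → f x ≈? y) dedup)
    where
    dedup = deduplicate _≈?_ xs
    in-dedup : ∀ z → z ∈ₗ dedup
    in-dedup z = MembershipP.∈-deduplicate⁺ setoid _≈?_ (λ y′≈y x≈y → ≈-trans x≈y (≈-sym y′≈y)) (xs-covers z)
    search : Dec (Any (λ x → f x ≈ y) dedup) → ∃ λ x → f x ≈ y
    search (yes hit) = Any.satisfied hit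
    search (no miss) = contradiction
      (unique-⊆⇒length≤ (¬Any⇒All¬ _ y∉image ∷ UniqueP.map⁺ setoid setoid f-inj (UniqueDecP.deduplicate-! S xs))
                        (All.tabulate (λ {z} _ → in-dedup z)))
      (λ len≤ → ℕ.n≮n _ (ℕ.≤-trans (s≤s (ℕ.≤-reflexive (sym (length-map f dedup)))) len≤))
      where
      y∉image : y ∉ₗ map f dedup
      y∉image y∈ with MembershipP.∈-map⁻ setoid setoid y∈
      ... | x , x∈ , y≈fx = miss (Any.map (λ x≈z → ≈-trans (f-cong (≈-sym x≈z)) (≈-sym y≈fx)) x∈)

-- Transfer to the group

module Transfer {g ℓ : Level} (G : AbelianGroup g ℓ) {k : ℕ} {q : Fin k → ℕ} (D : CyclicDecomposition G k q) where
  module G = AbelianGroup G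
  open G using (Carrier; _∙_; ε; _≈_)
  open ResidueVectors k q
  open CyclicDecomposition D public using (iso)
  open CyclicDecomposition D hiding (iso)

  ≡ₘ⇒≈ᵥ : ∀ {u v} → _≡ₘ_ G {q = q} u v → u ≈ᵥ v
  ≡ₘ⇒≈ᵥ u≡v = mk≈ λ i → mod-by (∣ᵤ⇒∣ (u≡v i))

  ≈ᵥ⇒≡ₘ : ∀ {u v} → u ≈ᵥ v → _≡ₘ_ G {q = q} u v
  ≈ᵥ⇒≡ₘ u≈v i = ∣⇒∣ᵤ (∣-difference (at u≈v i))

  iso-cong′ : ∀ {x y} → x ≈ y → iso x ≈ᵥ iso y
  iso-cong′ x≈y = ≡ₘ⇒≈ᵥ (iso-cong x≈y)

  iso-injective : ∀ {x y} → iso x ≈ᵥ iso y → x ≈ y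
  iso-injective ix≈iy = iso-inj (≈ᵥ⇒≡ₘ ix≈iy)

  iso-homo′ : ∀ x y → iso (x ∙ y) ≈ᵥ iso x ⊕ iso y
  iso-homo′ x y = ≡ₘ⇒≈ᵥ (iso-homo x y)

  section : V → Carrier
  section v = proj₁ (iso-surj v)

  iso-section : ∀ v → iso (section v) ≈ᵥ v
  iso-section v = ≡ₘ⇒≈ᵥ (proj₂ (iso-surj v))

  section-iso : ∀ x → section (iso x) ≈ x
  section-iso x = iso-injective (iso-section (iso x))

  iso-ε : iso ε ≈ᵥ 0ᵥ
  iso-ε = mk≈ λ i → mod-by (∣-scaled -1ℤ (∣-difference (at ε≈ε+ε i)) (lemma (iso ε i)))
    where
    ε≈ε+ε : iso ε ≈ᵥ iso ε ⊕ iso ε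
    ε≈ε+ε = ≈-trans (iso-cong′ (G.sym (G.identityˡ ε))) (iso-homo′ ε ε)
    lemma : ∀ a → a - 0ℤ ≡ -1ℤ * (a - (a + a))
    lemma = solve-∀

  private
    module Aut = Automorphism

  toAutomorphism : (φ ψ : Endo) → (∀ v → fun φ (fun ψ v) ≈ᵥ v) → (∀ v → fun ψ (fun φ v) ≈ᵥ v) → Automorphism G
  toAutomorphism φ ψ φψ≈id ψφ≈id = record
    { fun        = conj
    ; cong       = λ x≈y → iso-injective (≈-trans (iso-section _) (≈-trans (fun-cong φ (iso-cong′ x≈y)) (≈-sym (iso-section _))))
    ; homo       = λ x y → iso-injective (begin
        iso (conj (x ∙ y))                      ≈⟨ iso-section _ ⟩
        fun φ (iso (x ∙ y))                     ≈⟨ fun-cong φ (iso-homo′ x y) ⟩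
        fun φ (iso x ⊕ iso y)                   ≈⟨ fun-homo φ _ _ ⟩
        fun φ (iso x) ⊕ fun φ (iso y)           ≈⟨ ⊕-cong (≈-sym (iso-section _)) (≈-sym (iso-section _)) ⟩
        iso (conj x) ⊕ iso (conj y)             ≈⟨ ≈-sym (iso-homo′ _ _) ⟩
        iso (conj x ∙ conj y)                   ∎)
    ; injective  = λ {x} {y} conj-x≈conj-y → iso-injective (begin
        iso x                                   ≈⟨ ≈-sym (ψφ≈id (iso x)) ⟩
        fun ψ (fun φ (iso x))                   ≈⟨ fun-cong ψ (≈-sym (iso-section _)) ⟩
        fun ψ (iso (conj x))                    ≈⟨ fun-cong ψ (iso-cong′ conj-x≈conj-y) ⟩
        fun ψ (iso (conj y))                    ≈⟨ fun-cong ψ (iso-section _) ⟩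
        fun ψ (fun φ (iso y))                   ≈⟨ ψφ≈id (iso y) ⟩
        iso y                                   ∎)
    ; surjective = λ y → section (fun ψ (iso y)) , iso-injective (begin
        iso (conj (section (fun ψ (iso y))))    ≈⟨ iso-section _ ⟩
        fun φ (iso (section (fun ψ (iso y))))   ≈⟨ fun-cong φ (iso-section _) ⟩
        fun φ (fun ψ (iso y))                   ≈⟨ φψ≈id (iso y) ⟩
        iso y                                   ∎) }
    where
    open SetoidReasoning (DecSetoid.setoid decSetoid)
    conj : Carrier → Carrier
    conj x = section (fun φ (iso x))

  toAutomorphism-fpf : ∀ φ ψ φψ≈id ψφ≈id → FixedPointFree φ → Defs.FixedPointFree G (toAutomorphism φ ψ φψ≈id ψφ≈id)
  toAutomorphism-fpf φ ψ _ _ φ-fpf x conj-x≈x =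
    iso-injective (≈-trans (φ-fpf (iso x) (≈-trans (≈-sym (iso-section _)) (iso-cong′ conj-x≈x))) (≈-sym iso-ε))

  toEndo : Automorphism G → Endo
  toEndo α = record
    { fun      = λ v → iso (Aut.fun α (section v))
    ; fun-cong = λ u≈v → iso-cong′ (Aut.cong α (iso-injective (≈-trans (iso-section _) (≈-trans u≈v (≈-sym (iso-section _))))))
    ; fun-homo = λ u v → ≈-trans (iso-cong′ (Aut.cong α (iso-injective (begin
          iso (section (u ⊕ v))             ≈⟨ iso-section _ ⟩
          u ⊕ v                             ≈⟨ ⊕-cong (≈-sym (iso-section u)) (≈-sym (iso-section v)) ⟩
          iso (section u) ⊕ iso (section v) ≈⟨ ≈-sym (iso-homo′ _ _) ⟩
          iso (section u ∙ section v)       ∎))))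
        (≈-trans (iso-cong′ (Aut.homo α _ _)) (iso-homo′ _ _)) }
    where open SetoidReasoning (DecSetoid.setoid decSetoid)

  toEndo-injective : ∀ α → Injective (toEndo α)
  toEndo-injective α {v} {w} αv≈αw =
    ≈-trans (≈-sym (iso-section v)) (≈-trans (iso-cong′ (Aut.injective α (iso-injective αv≈αw))) (iso-section w))

  toEndo-fpf : ∀ α → Defs.FixedPointFree G α → FixedPointFree (toEndo α)
  toEndo-fpf α α-fpf v αv≈v =
    ≈-trans (≈-sym (iso-section v)) (≈-trans (iso-cong′ (α-fpf _ (iso-injective (≈-trans αv≈v (≈-sym (iso-section v)))))) iso-ε)

  toEndo-product : ∀ α β γ → (∀ x → Aut.fun α (Aut.fun β (Aut.fun γ x)) ≈ x) →
                   ∀ v → fun (toEndo α) (fun (toEndo β) (fun (toEndo γ) v)) ≈ᵥ v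
  toEndo-product α β γ αβγ≈id v = ≈-trans
    (iso-cong′ (G.trans (Aut.cong α (G.trans (section-iso _) (Aut.cong β (section-iso _)))) (αβγ≈id (section v))))
    (iso-section v)

  toModelTriple : HasFPFTriple G → FixedPointFreeTriple
  toModelTriple (α , β , γ , α-fpf , β-fpf , γ-fpf , αβγ≈id) = record
    { α = toEndo α ; β = toEndo β ; γ = toEndo γ
    ; α-injective = toEndo-injective α ; β-injective = toEndo-injective β ; γ-injective = toEndo-injective γ
    ; α-fixed-point-free = toEndo-fpf α α-fpf ; β-fixed-point-free = toEndo-fpf β β-fpf
    ; γ-fixed-point-free = toEndo-fpf γ γ-fpf
    ; αβγ≈id = toEndo-product α β γ αβγ≈id }

  fromSupportedTriple : Supported.SupportedTriple k q ⊤ → HasFPFTriple G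
  fromSupportedTriple t = A , B , C
    , toAutomorphism-fpf a (b ∘ₑ c) abc≈id bca≈id (full-support-fpf (α t))
    , toAutomorphism-fpf b (c ∘ₑ a) bca≈id cab≈id (full-support-fpf (β t))
    , toAutomorphism-fpf c (a ∘ₑ b) cab≈id abc≈id (full-support-fpf (γ t))
    , λ x → iso-injective (begin
        iso (Aut.fun A (Aut.fun B (Aut.fun C x)))  ≈⟨ iso-section _ ⟩
        fun a (iso (Aut.fun B (Aut.fun C x)))      ≈⟨ fun-cong a (iso-section _) ⟩
        fun a (fun b (iso (Aut.fun C x)))          ≈⟨ fun-cong a (fun-cong b (iso-section _)) ⟩
        fun a (fun b (fun c (iso x)))              ≈⟨ abc≈id (iso x) ⟩
        iso x                                      ∎)
    where
    open Supported k q
    open SetoidReasoning (DecSetoid.setoid decSetoid)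
    a = endo (α t)
    b = endo (β t)
    c = endo (γ t)
    abc≈id = αβγ≈id t
    bca≈id = βγα≈id t
    cab≈id = γαβ≈id t
    A = toAutomorphism a (b ∘ₑ c) abc≈id bca≈id
    B = toAutomorphism b (c ∘ₑ a) bca≈id cab≈id
    C = toAutomorphism c (a ∘ₑ b) cab≈id abc≈id

  open Membership (DecSetoid.setoid decSetoid) using () renaming (_∈_ to _∈ₗ_)

  enumerate : IsFinite G → ∃ λ (vs : List V) → ∀ v → v ∈ₗ vs
  enumerate (n , e , e-covers) = Data.List.tabulate (iso ∘ e) , λ v →
    let i , eᵢ≈sv = e-covers (section v) in
    MembershipP.∈-resp-≈ (DecSetoid.setoid decSetoid) (≈-trans (iso-cong′ eᵢ≈sv) (iso-section v))
                         (MembershipP.∈-tabulate⁺ (DecSetoid.setoid decSetoid) i)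

module _ {g ℓ : Level} (G : AbelianGroup g ℓ) {k : ℕ} {q : Fin k → ℕ}
         (q-prime-power : ∀ i → IsPrimePower (q i)) (D : CyclicDecomposition G k q) where
  open ResidueVectors k q
  open Transfer G D

  sufficiency : Condition2 k q → HasFPFTriple G
  sufficiency paired = fromSupportedTriple (Assembly.fullTriple k q q-prime-power λ {i} _ i-2or3 →
    let j , j≢i , q[j]≡q[i] = paired i i-2or3 in j , j≢i , ∈⊤ , q[j]≡q[i])

  necessity : IsFinite G → HasFPFTriple G → Condition2 k q
  necessity finite fpf-triple i i-2or3 with Fin.any? (λ j → ¬? (j ≟ i) ×-dec (q j ℕ.≟ q i))
  ... | yes partner = partner
  ... | no no-partner = ⊥-elim (impossible i-2or3)
    where
    open FixedPointFreeTriple (toModelTriple fpf-triple)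
    unique : ∀ j → q j ≡ q i → j ≡ i
    unique j q[j]≡q[i] with j ≟ i
    ... | yes j≡i = j≡i
    ... | no j≢i = contradiction (j , j≢i , q[j]≡q[i]) no-partner
    injective⇒surjective : ∀ φ → Injective φ → Surjective φ
    injective⇒surjective φ = FiniteDecSetoid.injective⇒surjective decSetoid (proj₂ (enumerate finite)) (fun-cong φ)
    impossible : IsPowerOf2or3 (q i) → ⊥
    impossible (m , inj₁ q[i]≡2ᵐ⁺¹) = Layer.no-fpf-automorphism k q q-prime-power i {m = m} prime[2] q[i]≡2ᵐ⁺¹ unique
      injective⇒surjective refl α α-injective α-fixed-point-free
    impossible (m , inj₂ q[i]≡3ᵐ⁺¹) = Layer.no-fpf-triple k q q-prime-power i {m = m} (from-yes (prime? 3)) q[i]≡3ᵐ⁺¹ unique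
      injective⇒surjective refl (toModelTriple fpf-triple)

proposition3 : ∀ {c ℓ : Level} (G : AbelianGroup c ℓ) → IsFinite G →
    (k : ℕ) (q : Fin k → ℕ) → (∀ i → IsPrimePower (q i)) → CyclicDecomposition G k q →
    HasFPFTriple G ⇔ Condition2 k q
proposition3 G finite k q q-prime-power D = mk⇔ (necessity G q-prime-power D finite) (sufficiency G q-prime-power D)
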